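{- Let $r,s\ge1$, $d=r+s-1$, and $\mathbb{F}$ a field. Let $h(i,n)\in\mathbb{F}$ be given for $0\le i\le d$, $0\le n\le r-1$, with $h(i,0)=1$ for all $i$ and $h(i,n)=0$ whenever $i<n$. For $t\in\mathbb{F}$ and $0\le n\le r-1$ let $a^{[n]}(t)\in\mathbb{F}^{d+1}$ be the vector whose $i$-th coordinate ($0\le i\le d$) is $h(i,n)\,t^{\,i-n}$ (with $0^0=1$), and let $H(t)$ be the span of $a^{[0]}(t),\dots,a^{[r-1]}(t)$. For $0\le i_1<\dots<i_r\le d$ put $h(i_1,\dots,i_r)=\det\big(h(i_q,n)\big)_{n=0,\dots,r-1;\ q=1,\dots,r}$, so that $H(t)$ has Plücker coordinates $H_{i_1\dots i_r}(t)=h(i_1,\dots,i_r)\,t^{\,i_1+\dots+i_r-\binom{r}{2}}$. Suppose $h(i_1,\dots,i_r)\ne0$ for all $0\le i_1<\dots<i_r\le d$. Then $\{H(t)^\perp:t\in\mathbb{F}\}$ is an $s$-uniform strong $(r,sr)$ subspace design in $\mathbb{F}^{r+s}$, and $\{H(t):t\in\mathbb{F}\}$ is an $r$-uniform strong $(s,rs)$ subspace design in $\mathbb{F}^{r+s}$.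
   Context: Plücker coordinates of a rank-$r$ subspace with basis $a(1),\dots,a(r)$ are the maximal minors $\det(a(p)_{i_q})_{p,q=1}^r$. $H^\perp$ is the orthogonal complement with respect to the standard bilinear form $\sum_i a_ib_i$. A collection $\{H_1,\dots,H_N\}$ of rank-$r$ subspaces of $\mathbb{F}^m$ is an $r$-uniform strong $(s,A)$ subspace design if for every linear subspace $W\le\mathbb{F}^m$ of rank $s$, $\sum_{i}\mathrm{rank}(H_i\cap W)\le A$. -}

module Defs where

open import Level using (Level; _⊔_)
open import Algebra.Bundles using (CommutativeRing)
open import Data.Nat using (ℕ; zero; suc; _∸_; _≤_)
import Data.Nat as ℕ
open import Data.Fin using (Fin; zero; suc; toℕ; punchIn)
open import Data.Product using (Σ; ∃; _×_)
open import Relation.Nullary using (¬_)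
open import Relation.Binary.PropositionalEquality using (_≡_)

record Field (c ℓ : Level) : Set (Level.suc (c ⊔ ℓ)) where
  field
    commutativeRing : CommutativeRing c ℓ
  open CommutativeRing commutativeRing public
  field
    1≉0     : ¬ (1# ≈ 0#)
    inverse : ∀ x → ¬ (x ≈ 0#) → ∃ λ y → x * y ≈ 1#

sumℕ : (k : ℕ) → (Fin k → ℕ) → ℕ
sumℕ zero    f = 0
sumℕ (suc k) f = f zero ℕ.+ sumℕ k (λ j → f (suc j))

module LinAlg {c ℓ : Level} (F : Field c ℓ) where
  open Field F public using (Carrier; _≈_; 0#; 1#)
  open Field F using (_+_; _*_; -_)

  Vect : ℕ → Set c
  Vect m = Fin m → Carrier

  _≈ᵥ_ : ∀ {m} → Vect m → Vect m → Set ℓ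
  u ≈ᵥ v = ∀ i → u i ≈ v i

  zeroᵥ : ∀ {m} → Vect m
  zeroᵥ _ = 0#

  sumF : (k : ℕ) → (Fin k → Carrier) → Carrier
  sumF zero    f = 0#
  sumF (suc k) f = f zero + sumF k (λ j → f (suc j))

  pow : Carrier → ℕ → Carrier
  pow t zero    = 1#
  pow t (suc k) = t * pow t k

  signed : ℕ → Carrier → Carrier
  signed zero    x = x
  signed (suc j) x = - (signed j x)

  det : (n : ℕ) → (Fin n → Fin n → Carrier) → Carrier
  det zero    M = 1#
  det (suc n) M = sumF (suc n) (λ j →
    signed (toℕ j) (M zero j * det n (λ p q → M (suc p) (punchIn j q))))

  dot : ∀ {m} → Vect m → Vect m → Carrier
  dot {m} u v = sumF m (λ i → u i * v i)

  lincomb : ∀ {m k} → (Fin k → Carrier) → (Fin k → Vect m) → Vect m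
  lincomb {k = k} cs v i = sumF k (λ j → cs j * v j i)

  Subspace : ℕ → Set (Level.suc (c ⊔ ℓ))
  Subspace m = Vect m → Set (c ⊔ ℓ)

  Span : ∀ {m k} → (Fin k → Vect m) → Subspace m
  Span {k = k} v x = ∃ λ (cs : Fin k → Carrier) → x ≈ᵥ lincomb cs v

  _∩_ : ∀ {m} → Subspace m → Subspace m → Subspace m
  (U ∩ W) x = U x × W x

  Perp : ∀ {m} → Subspace m → Subspace m
  Perp U x = ∀ y → U y → dot x y ≈ 0#

  LinIndep : ∀ {m k} → (Fin k → Vect m) → Set (c ⊔ ℓ)
  LinIndep {k = k} v = ∀ (cs : Fin k → Carrier) → lincomb cs v ≈ᵥ zeroᵥ → ∀ j → cs j ≈ 0#

  RankAtLeast : ∀ {m} → Subspace m → ℕ → Set (c ⊔ ℓ)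
  RankAtLeast {m} U k = ∃ λ (v : Fin k → Vect m) → (∀ j → U (v j)) × LinIndep v

  HasRank : ∀ {m} → Subspace m → ℕ → Set (c ⊔ ℓ)
  HasRank U k = RankAtLeast U k × ¬ RankAtLeast U (ℕ.suc k)

  -- {H t : t ∈ F} is an rk-uniform strong (s , A) subspace design in F^m:
  -- every H t has rank rk, and for every rank-s subspace W (given by a basis w),
  -- Σ_{t∈F} rank (H t ∩ W) ≤ A; the sum over the (possibly infinite) index set F
  -- is expressed as: every finite partial sum over distinct t's of lower bounds
  -- for the ranks is ≤ A.
  StrongDesign : ∀ {m} → (Carrier → Subspace m) → (rk s A : ℕ) → Set (c ⊔ ℓ)
  StrongDesign {m} H rk s A =
    (∀ t → HasRank (H t) rk) ×
    (∀ (w : Fin s → Vect m) → LinIndep w →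
     ∀ (k : ℕ) (ts : Fin k → Carrier) → (∀ i j → ts i ≈ ts j → i ≡ j) →
     ∀ (ks : Fin k → ℕ) → (∀ j → RankAtLeast (H (ts j) ∩ Span w) (ks j)) →
     sumℕ k ks ≤ A)

  aVec : ∀ {r s} → (Fin (r ℕ.+ s) → Fin r → Carrier) → Fin r → Carrier → Vect (r ℕ.+ s)
  aVec h n t i = h i n * pow t (toℕ i ∸ toℕ n)

  Hsp : ∀ {r s} → (Fin (r ℕ.+ s) → Fin r → Carrier) → Carrier → Subspace (r ℕ.+ s)
  Hsp h t = Span (λ n → aVec h n t)

module Submission where

-- For a subspace W and r vectors φ in reversed echelon form attached to it
-- (a basis of W, or vectors spanning W^⊥), the pairings ⟨φ j, a^[i](t)⟩ are
-- the values at t of an r × r polynomial matrix N φ.  Independent vectors in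
-- H(t) ∩ W (resp. H(t)^⊥ ∩ W) give independent kernel vectors of N φ (t), so
-- the rank of the intersection is at most the multiplicity of t as a root of
-- det N φ.  Shifting row i by X^i shows that det N φ has a nonzero maximal
-- minor of h as leading coefficient and degree ≤ r·s, which bounds the sum.

import Algebra.Bundles
import Defs
import Data.Nat
import Data.Fin
import Relation.Nullary

-- The module is instantiated twice:
-- at the field F and at the polynomial ring F[X].
module Determinant {c ℓ} (R : Algebra.Bundles.CommutativeRing c ℓ) where

  open import Algebra.Bundles using (CommutativeRing)
  open import Data.Nat as ℕ using (ℕ; zero; suc)
  open import Data.Fin as Fin using (Fin; zero; suc; toℕ; punchIn)
  open import Data.Fin.Properties using (punchInᵢ≢i)
  import Data.Nat.Properties as ℕP
  open import Data.Vec.Functional using (updateAt)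
  open import Data.Vec.Functional.Properties using (updateAt-updates; updateAt-minimal; updateAt-id-local; updateAt-commutes)
  open import Relation.Binary.PropositionalEquality as P using (_≡_; _≢_)
  open import Relation.Nullary using (yes; no)
  open import Data.Empty using (⊥-elim)
  open import Function using (_∘_; const)
  open import Level using (_⊔_)

  open CommutativeRing R hiding (zero)
  open import Relation.Binary.Reasoning.Setoid setoid
  open import Algebra.Properties.Ring ring using (-‿distribʳ-*; -0#≈0#; -‿+-comm; x≈y⇒x∙y⁻¹≈ε)
  open import Algebra.Properties.CommutativeSemigroup *-commutativeSemigroup using (x∙yz≈y∙xz)
  open import Algebra.Properties.Semiring.Sum semiring public
    using (sum; sum-cong-≋; sum-replicate-zero; ∑-distrib-+; ∑-comm; *-distribˡ-sum; *-distribʳ-sum; sum-remove; sum-permute)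

  sum-0 : ∀ {k} {f : Fin k → Carrier} → (∀ i → f i ≈ 0#) → sum f ≈ 0#
  sum-0 {k} e = trans (sum-cong-≋ e) (sum-replicate-zero k)

  sum-neg : ∀ {k} (f : Fin k → Carrier) → - sum f ≈ sum (λ i → - f i)
  sum-neg {zero}  f = -0#≈0#
  sum-neg {suc k} f = trans (sym (-‿+-comm _ _)) (+-congˡ (sum-neg (f ∘ suc)))

  sum-delta : ∀ {k} (l : Fin k) (f : Fin k → Carrier) → (∀ i → i ≢ l → f i ≈ 0#) → sum f ≈ f l
  sum-delta {suc k} l f e = begin
    sum f                                ≈⟨ sum-remove {i = l} f ⟩
    f l + sum (λ j → f (punchIn l j))    ≈⟨ +-congˡ (sum-0 (λ j → e _ (punchInᵢ≢i l j))) ⟩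
    f l + 0#                             ≈⟨ +-identityʳ _ ⟩
    f l                                  ∎

  signed : ℕ → Carrier → Carrier
  signed zero    x = x
  signed (suc j) x = - (signed j x)

  signed-cong : ∀ k {x y} → x ≈ y → signed k x ≈ signed k y
  signed-cong zero    e = e
  signed-cong (suc k) e = -‿cong (signed-cong k e)

  signed-+ : ∀ k x y → signed k (x + y) ≈ signed k x + signed k y
  signed-+ zero    x y = refl
  signed-+ (suc k) x y = trans (-‿cong (signed-+ k x y)) (sym (-‿+-comm _ _))

  signed-* : ∀ k a x → signed k (a * x) ≈ a * signed k x
  signed-* zero    a x = refl
  signed-* (suc k) a x = trans (-‿cong (signed-* k a x)) (-‿distribʳ-* _ _)

  signed-0 : ∀ k {x} → x ≈ 0# → signed k x ≈ 0#
  signed-0 zero    e = e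
  signed-0 (suc k) e = trans (-‿cong (signed-0 k e)) -0#≈0#

  signed-signed : ∀ i j x → signed i (signed j x) ≡ signed (i ℕ.+ j) x
  signed-signed zero    j x = P.refl
  signed-signed (suc i) j x = P.cong -_ (signed-signed i j x)

  signed-swap : ∀ i j {x y} → x ≈ y → signed (suc j) (signed i x) ≈ signed (suc i) (signed j y)
  signed-swap i j {x} {y} e = begin
    signed (suc j) (signed i x) ≡⟨ signed-signed (suc j) i x ⟩
    signed (suc j ℕ.+ i) x      ≡⟨ P.cong (λ n → signed (suc n) x) (ℕP.+-comm j i) ⟩
    signed (suc i ℕ.+ j) x      ≈⟨ signed-cong (suc i ℕ.+ j) e ⟩
    signed (suc i ℕ.+ j) y      ≡⟨ P.sym (signed-signed (suc i) j y) ⟩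
    signed (suc i) (signed j y) ∎

  signed-*-sum : ∀ k {n} x (f : Fin n → Carrier) → signed k (x * sum f) ≈ sum (λ i → signed k (x * f i))
  signed-*-sum k {zero}  x f = signed-0 k (zeroʳ x)
  signed-*-sum k {suc n} x f = begin
    signed k (x * (f zero + sum (f ∘ suc)))
      ≈⟨ signed-cong k (distribˡ x _ _) ⟩
    signed k (x * f zero + x * sum (f ∘ suc))
      ≈⟨ signed-+ k _ _ ⟩
    signed k (x * f zero) + signed k (x * sum (f ∘ suc))
      ≈⟨ +-congˡ (signed-*-sum k x (f ∘ suc)) ⟩
    signed k (x * f zero) + sum (λ i → signed k (x * f (suc i))) ∎

  Mat : ℕ → Set c
  Mat n = Fin n → Fin n → Carrier

  minor : ∀ {n} → Mat (suc n) → Fin (suc n) → Mat n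
  minor M j p q = M (suc p) (punchIn j q)

  det : (n : ℕ) → Mat n → Carrier
  det zero    M = 1#
  det (suc n) M = sum (λ j → signed (toℕ j) (M zero j * det n (minor M j)))

  det-cong : ∀ n {M N : Mat n} → (∀ i j → M i j ≈ N i j) → det n M ≈ det n N
  det-cong zero    e = refl
  det-cong (suc n) e = sum-cong-≋ (λ j → signed-cong (toℕ j)
    (*-cong (e zero j) (det-cong n (λ p q → e (suc p) (punchIn j q)))))

  infixl 9 _[_]≔_
  _[_]≔_ : ∀ {n m} → (Fin n → Fin m → Carrier) → Fin n → (Fin m → Carrier) → Fin n → Fin m → Carrier
  M [ l ]≔ u = updateAt M l (const u)

  replaced-row : ∀ {n m} (M : Fin n → Fin m → Carrier) l u q → (M [ l ]≔ u) l q ≈ u q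
  replaced-row M l u q = reflexive (P.cong-app (updateAt-updates l M) q)

  other-row : ∀ {n m} (M : Fin n → Fin m → Carrier) l u i q → i ≢ l → (M [ l ]≔ u) i q ≈ M i q
  other-row M l u i q i≢l = reflexive (P.cong-app (updateAt-minimal i l M i≢l) q)

  replace-self : ∀ {n m} (M : Fin n → Fin m → Carrier) l i q → (M [ l ]≔ M l) i q ≈ M i q
  replace-self M l i q = reflexive (P.cong-app (updateAt-id-local l M P.refl i) q)

  replace-cong : ∀ {n m} (M : Fin n → Fin m → Carrier) l {u v : Fin m → Carrier} → (∀ q → u q ≈ v q) →
                 ∀ i q → (M [ l ]≔ u) i q ≈ (M [ l ]≔ v) i q
  replace-cong M l {u} {v} e i q with i Fin.≟ l
  ... | yes P.refl = trans (replaced-row M i u q) (trans (e q) (sym (replaced-row M i v q)))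
  ... | no i≢l     = trans (other-row M l u i q i≢l) (sym (other-row M l v i q i≢l))

  replace-comm : ∀ {n m} (M : Fin n → Fin m → Carrier) l l' u v → l ≢ l' → ∀ i q →
                 (M [ l ]≔ u [ l' ]≔ v) i q ≈ (M [ l' ]≔ v [ l ]≔ u) i q
  replace-comm M l l' u v l≢l' i q =
    reflexive (P.cong-app (updateAt-commutes l' l (λ e → l≢l' (P.sym e)) M i) q)

  minor-replace : ∀ {n k} (M : Fin (suc n) → Fin (suc k) → Carrier) l w j p q →
    (M [ suc l ]≔ w) (suc p) (punchIn j q) ≡ ((λ p q → M (suc p) (punchIn j q)) [ l ]≔ (w ∘ punchIn j)) p q
  minor-replace M zero    w j zero    q = P.refl
  minor-replace M zero    w j (suc p) q = P.refl
  minor-replace M (suc l) w j zero    q = P.refl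
  minor-replace M (suc l) w j (suc p) q = minor-replace (M ∘ punchIn (suc zero)) l w j p q

  -- Multilinearity in each row.  Both laws are first shown for a single
  -- Laplace sum and then propagated to deeper rows through the minors.

  laplace-+ : ∀ k (x A B C : Fin k → Carrier) → (∀ j → A j ≈ B j + C j) →
    sum (λ j → signed (toℕ j) (x j * A j))
      ≈ sum (λ j → signed (toℕ j) (x j * B j)) + sum (λ j → signed (toℕ j) (x j * C j))
  laplace-+ k x A B C e = trans
    (sum-cong-≋ (λ j → trans (signed-cong (toℕ j) (trans (*-congˡ (e j)) (distribˡ (x j) (B j) (C j))))
                             (signed-+ (toℕ j) (x j * B j) (x j * C j))))
    (∑-distrib-+ (λ j → signed (toℕ j) (x j * B j)) (λ j → signed (toℕ j) (x j * C j)))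

  laplace-* : ∀ k (x : Fin k → Carrier) a (A B : Fin k → Carrier) → (∀ j → A j ≈ a * B j) →
    sum (λ j → signed (toℕ j) (x j * A j)) ≈ a * sum (λ j → signed (toℕ j) (x j * B j))
  laplace-* k x a A B e = trans
    (sum-cong-≋ (λ j → trans (signed-cong (toℕ j) (trans (*-congˡ (e j)) (x∙yz≈y∙xz (x j) a (B j))))
                             (signed-* (toℕ j) a (x j * B j))))
    (sym (*-distribˡ-sum a (λ j → signed (toℕ j) (x j * B j))))

  det-row-+ : ∀ n (M : Mat n) l (u v : Fin n → Carrier) →
    det n (M [ l ]≔ (λ q → u q + v q)) ≈ det n (M [ l ]≔ u) + det n (M [ l ]≔ v)
  det-row-+ (suc n) M zero u v =
    trans (sum-cong-≋ (λ j → signed-cong (toℕ j) (*-comm (u j + v j) (D j))))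
    (trans (laplace-+ (suc n) D (λ j → u j + v j) u v (λ j → refl))
           (+-cong (sum-cong-≋ (λ j → signed-cong (toℕ j) (*-comm (D j) (u j))))
                   (sum-cong-≋ (λ j → signed-cong (toℕ j) (*-comm (D j) (v j))))))
    where D : Fin (suc n) → Carrier
          D j = det n (minor M j)
  det-row-+ (suc (suc n)) M (suc l) u v =
    laplace-+ (suc (suc n)) (M zero) (minorDet (λ q → u q + v q)) (minorDet u) (minorDet v) (λ j → begin
      minorDet (λ q → u q + v q) j
        ≈⟨ det-cong (suc n) (λ p q → reflexive (minor-replace M l (λ q → u q + v q) j p q)) ⟩
      det (suc n) (minor M j [ l ]≔ (λ q → u (punchIn j q) + v (punchIn j q)))
        ≈⟨ det-row-+ (suc n) (minor M j) l (u ∘ punchIn j) (v ∘ punchIn j) ⟩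
      det (suc n) (minor M j [ l ]≔ (u ∘ punchIn j)) + det (suc n) (minor M j [ l ]≔ (v ∘ punchIn j))
        ≈⟨ sym (+-cong (det-cong (suc n) (λ p q → reflexive (minor-replace M l u j p q)))
                       (det-cong (suc n) (λ p q → reflexive (minor-replace M l v j p q)))) ⟩
      minorDet u j + minorDet v j ∎)
    where minorDet : (Fin (suc (suc n)) → Carrier) → Fin (suc (suc n)) → Carrier
          minorDet w j = det (suc n) (minor (M [ suc l ]≔ w) j)

  det-row-* : ∀ n (M : Mat n) l a (u : Fin n → Carrier) →
    det n (M [ l ]≔ (λ q → a * u q)) ≈ a * det n (M [ l ]≔ u)
  det-row-* (suc n) M zero a u =
    trans (sum-cong-≋ (λ j → signed-cong (toℕ j) (*-comm (a * u j) (D j))))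
    (trans (laplace-* (suc n) D a (λ j → a * u j) u (λ j → refl))
           (*-congˡ (sum-cong-≋ (λ j → signed-cong (toℕ j) (*-comm (D j) (u j))))))
    where D : Fin (suc n) → Carrier
          D j = det n (minor M j)
  det-row-* (suc (suc n)) M (suc l) a u =
    laplace-* (suc (suc n)) (M zero) a (minorDet (λ q → a * u q)) (minorDet u) (λ j → begin
      minorDet (λ q → a * u q) j
        ≈⟨ det-cong (suc n) (λ p q → reflexive (minor-replace M l (λ q → a * u q) j p q)) ⟩
      det (suc n) (minor M j [ l ]≔ (λ q → a * u (punchIn j q)))
        ≈⟨ det-row-* (suc n) (minor M j) l a (u ∘ punchIn j) ⟩
      a * det (suc n) (minor M j [ l ]≔ (u ∘ punchIn j))
        ≈⟨ *-congˡ (sym (det-cong (suc n) (λ p q → reflexive (minor-replace M l u j p q)))) ⟩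
      a * minorDet u j ∎)
    where minorDet : (Fin (suc (suc n)) → Carrier) → Fin (suc (suc n)) → Carrier
          minorDet w j = det (suc n) (minor (M [ suc l ]≔ w) j)

  det-row-0 : ∀ n (M : Mat n) l → det n (M [ l ]≔ (λ _ → 0#)) ≈ 0#
  det-row-0 n M l = begin
    det n (M [ l ]≔ (λ _ → 0#))      ≈⟨ det-cong n (replace-cong M l (λ _ → sym (zeroˡ 0#))) ⟩
    det n (M [ l ]≔ (λ _ → 0# * 0#)) ≈⟨ det-row-* n M l 0# (λ _ → 0#) ⟩
    0# * _                           ≈⟨ zeroˡ _ ⟩
    0#                               ∎

  det-row-sum : ∀ n (M : Mat n) l k (cf : Fin k → Carrier) (U : Fin k → Fin n → Carrier) →
    det n (M [ l ]≔ (λ q → sum (λ i → cf i * U i q))) ≈ sum (λ i → cf i * det n (M [ l ]≔ U i))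
  det-row-sum n M l zero    cf U = det-row-0 n M l
  det-row-sum n M l (suc k) cf U = begin
    det n (M [ l ]≔ (λ q → cf zero * U zero q + sum (λ i → cf (suc i) * U (suc i) q)))
      ≈⟨ det-row-+ n M l _ _ ⟩
    det n (M [ l ]≔ (λ q → cf zero * U zero q)) + det n (M [ l ]≔ (λ q → sum (λ i → cf (suc i) * U (suc i) q)))
      ≈⟨ +-cong (det-row-* n M l (cf zero) (U zero)) (det-row-sum n M l k (cf ∘ suc) (U ∘ suc)) ⟩
    cf zero * det n (M [ l ]≔ U zero) + sum (λ i → cf (suc i) * det n (M [ l ]≔ U (suc i))) ∎

  -- Expansion along column 0, and hence invariance under transposition.  The
  -- two double Laplace expansions agree term by term after exchanging sums.

  columnExpansion : ∀ n → Mat (suc n) → Carrier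
  columnExpansion n M = sum (λ i → signed (toℕ i) (M i zero * det n (λ p q → M (punchIn i p) (suc q))))

  det-column-expansion : ∀ n (M : Mat (suc n)) → det (suc n) M ≈ columnExpansion n M
  det-column-expansion zero    M = refl
  det-column-expansion (suc n) M = +-congˡ (begin
    sum (λ j → signed (suc (toℕ j)) (a j * det (suc n) (minor M (suc j))))
      ≈⟨ sum-cong-≋ {x = λ j → signed (suc (toℕ j)) (a j * det (suc n) (minor M (suc j)))}
                    {y = λ j → signed (suc (toℕ j)) (a j * sum (λ i → signed (toℕ i) (b i * D i j)))}
           (λ j → signed-cong (suc (toℕ j)) (*-congˡ (det-column-expansion n (minor M (suc j))))) ⟩
    sum (λ j → signed (suc (toℕ j)) (a j * sum (λ i → signed (toℕ i) (b i * D i j))))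
      ≈⟨ sum-cong-≋ (λ j → signed-*-sum (suc (toℕ j)) (a j) (λ i → signed (toℕ i) (b i * D i j))) ⟩
    sum (λ j → sum (λ i → signed (suc (toℕ j)) (a j * signed (toℕ i) (b i * D i j))))
      ≈⟨ ∑-comm (λ j i → signed (suc (toℕ j)) (a j * signed (toℕ i) (b i * D i j))) ⟩
    sum (λ i → sum (λ j → signed (suc (toℕ j)) (a j * signed (toℕ i) (b i * D i j))))
      ≈⟨ sum-cong-≋ (λ i → sum-cong-≋ (λ j → term i j)) ⟩
    sum (λ i → sum (λ j → signed (suc (toℕ i)) (b i * signed (toℕ j) (a j * D i j))))
      ≈⟨ sym (sum-cong-≋ (λ i → signed-*-sum (suc (toℕ i)) (b i) (λ j → signed (toℕ j) (a j * D i j)))) ⟩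
    sum (λ i → signed (suc (toℕ i)) (b i * sum (λ j → signed (toℕ j) (a j * D i j)))) ∎)
    where
    a b : Fin (suc n) → Carrier
    a j = M zero (suc j)
    b i = M (suc i) zero
    D : Fin (suc n) → Fin (suc n) → Carrier
    D i j = det n (λ p q → M (suc (punchIn i p)) (suc (punchIn j q)))
    term : ∀ i j → signed (suc (toℕ j)) (a j * signed (toℕ i) (b i * D i j))
                 ≈ signed (suc (toℕ i)) (b i * signed (toℕ j) (a j * D i j))
    term i j = begin
      signed (suc (toℕ j)) (a j * signed (toℕ i) (b i * D i j))
        ≈⟨ signed-cong (suc (toℕ j)) (sym (signed-* (toℕ i) (a j) _)) ⟩
      signed (suc (toℕ j)) (signed (toℕ i) (a j * (b i * D i j)))
        ≈⟨ signed-swap (toℕ i) (toℕ j) (x∙yz≈y∙xz (a j) (b i) (D i j)) ⟩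
      signed (suc (toℕ i)) (signed (toℕ j) (b i * (a j * D i j)))
        ≈⟨ signed-cong (suc (toℕ i)) (signed-* (toℕ j) (b i) _) ⟩
      signed (suc (toℕ i)) (b i * signed (toℕ j) (a j * D i j)) ∎

  det-transpose : ∀ n (M : Mat n) → det n (λ i j → M j i) ≈ det n M
  det-transpose zero    M = refl
  det-transpose (suc n) M = trans
    (sum-cong-≋ {x = λ j → signed (toℕ j) (M j zero * det n (λ p q → M (punchIn j q) (suc p)))}
                {y = λ j → signed (toℕ j) (M j zero * det n (λ p q → M (punchIn j p) (suc q)))}
                (λ j → signed-cong (toℕ j) (*-congˡ (det-transpose n (λ p q → M (punchIn j p) (suc q))))))
    (sym (det-column-expansion n M))

  det-two-rows-+ : ∀ n (M : Mat n) l l' (u v : Fin n → Carrier) → l ≢ l' →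
    det n (M [ l ]≔ (λ q → u q + v q) [ l' ]≔ (λ q → u q + v q))
      ≈ (det n (M [ l' ]≔ u [ l ]≔ u) + det n (M [ l' ]≔ u [ l ]≔ v))
        + (det n (M [ l' ]≔ v [ l ]≔ u) + det n (M [ l' ]≔ v [ l ]≔ v))
  det-two-rows-+ n M l l' u v l≢l' = begin
    det n (M [ l ]≔ W [ l' ]≔ W)
      ≈⟨ det-row-+ n (M [ l ]≔ W) l' u v ⟩
    det n (M [ l ]≔ W [ l' ]≔ u) + det n (M [ l ]≔ W [ l' ]≔ v)
      ≈⟨ +-cong (det-cong n (replace-comm M l l' W u l≢l')) (det-cong n (replace-comm M l l' W v l≢l')) ⟩
    det n (M [ l' ]≔ u [ l ]≔ W) + det n (M [ l' ]≔ v [ l ]≔ W)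
      ≈⟨ +-cong (det-row-+ n (M [ l' ]≔ u) l u v) (det-row-+ n (M [ l' ]≔ v) l u v) ⟩
    (det n (M [ l' ]≔ u [ l ]≔ u) + det n (M [ l' ]≔ u [ l ]≔ v))
      + (det n (M [ l' ]≔ v [ l ]≔ u) + det n (M [ l' ]≔ v [ l ]≔ v)) ∎
    where W : Fin n → Carrier
          W q = u q + v q

  -- Proved
  -- by induction on the size, in three cases according to the positions
  -- a < b of the equal rows: both ≥ 1 (every minor along row 0 has two equal
  -- rows), (0, 1) (the first two terms of the column expansion cancel, the
  -- others have two equal rows), and (0, b) with b ≥ 2 (reduced to the other
  -- two cases by bilinearity in rows 1 and b).

  Alternating : ℕ → Set (c ⊔ ℓ)
  Alternating n = ∀ (M : Mat n) (a b : Fin n) → a ≢ b → (∀ q → M a q ≈ M b q) → det n M ≈ 0#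

  -- Equal rows a, b ≥ 1: every minor along row 0 has two equal rows.
  alternating-≥1 : ∀ n → Alternating n → ∀ (M : Mat (suc n)) a b → a ≢ b →
                   (∀ q → M (suc a) q ≈ M (suc b) q) → det (suc n) M ≈ 0#
  alternating-≥1 n IH M a b a≢b e = sum-0 {suc n} (λ j → signed-0 (toℕ j) {M zero j * det n (minor M j)}
    (trans (*-congˡ (IH (minor M j) a b a≢b (λ q → e (punchIn j q)))) (zeroʳ _)))

  -- In the column expansion of a matrix whose rows 0 and 1 agree, the terms
  -- for i ≥ 2 vanish: their minors still contain both rows.
  column-expansion-tail : ∀ n → Alternating (suc n) → ∀ (M : Mat (suc (suc n))) →
    (∀ q → M zero q ≈ M (suc zero) q) →
    sum (λ i → signed (suc (suc (toℕ i)))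
           (M (suc (suc i)) zero * det (suc n) (λ p q → M (punchIn (suc (suc i)) p) (suc q)))) ≈ 0#
  column-expansion-tail zero    IH M e = refl
  column-expansion-tail (suc n) IH M e = sum-0 {suc n} (λ i → signed-0 (suc (suc (toℕ i)))
    {M (suc (suc i)) zero * det (suc (suc n)) (λ p q → M (punchIn (suc (suc i)) p) (suc q))}
    (trans (*-congˡ (IH (λ p q → M (punchIn (suc (suc i)) p) (suc q)) zero (suc zero) (λ ()) (λ q → e (suc q)))) (zeroʳ _)))

  -- Equal rows 0 and 1: the first two terms of the column expansion cancel.
  alternating-01 : ∀ n → Alternating (suc n) → ∀ (M : Mat (suc (suc n))) →
                   (∀ q → M zero q ≈ M (suc zero) q) → det (suc (suc n)) M ≈ 0#
  alternating-01 n IH M e = begin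
    det (suc (suc n)) M                                   ≈⟨ det-column-expansion (suc n) M ⟩
    M zero zero * D0 + (- (M (suc zero) zero * D1) + rest) ≈⟨ +-congˡ (+-congˡ rest≈0) ⟩
    M zero zero * D0 + (- (M (suc zero) zero * D1) + 0#)   ≈⟨ +-congˡ (+-identityʳ _) ⟩
    M zero zero * D0 + - (M (suc zero) zero * D1)          ≈⟨ x≈y⇒x∙y⁻¹≈ε (*-cong (e zero) (det-cong (suc n) D0≈D1)) ⟩
    0#                                                    ∎
    where
    D0 D1 : Carrier
    D0 = det (suc n) (λ p q → M (suc p) (suc q))
    D1 = det (suc n) (λ p q → M (punchIn (suc zero) p) (suc q))
    D0≈D1 : ∀ p q → M (suc p) (suc q) ≈ M (punchIn (suc zero) p) (suc q)
    D0≈D1 zero    q = sym (e (suc q))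
    D0≈D1 (suc p) q = refl
    rest : Carrier
    rest = sum (λ i → signed (suc (suc (toℕ i)))
                  (M (suc (suc i)) zero * det (suc n) (λ p q → M (punchIn (suc (suc i)) p) (suc q))))
    rest≈0 : rest ≈ 0#
    rest≈0 = column-expansion-tail n IH M e

  -- Equal rows 0 and b ≥ 2: put row 1 + row b into rows 1 and b and expand;
  -- the result has equal rows 1 and b, three of the four terms have equal
  -- rows too, and the fourth is det M.
  alternating-0b : ∀ n → Alternating (suc (suc n)) → ∀ (M : Mat (suc (suc (suc n)))) b →
                   (∀ q → M zero q ≈ M (suc (suc b)) q) → det (suc (suc (suc n))) M ≈ 0#
  alternating-0b n IH M b' e = begin
    det N M
      ≈⟨ sym (trans (+-congʳ M[b≔1,1≔b]≈0) (+-identityˡ _)) ⟩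
    det N (M [ b ]≔ M one [ one ]≔ M b) + det N M
      ≈⟨ sym (+-cong (trans (+-congʳ M[b≔1,1≔1]≈0) (+-identityˡ _))
                     (trans (+-cong M[b≔b,1≔1]≈M M[b≔b,1≔b]≈0) (+-identityʳ _))) ⟩
    (det N (M [ b ]≔ M one [ one ]≔ M one) + det N (M [ b ]≔ M one [ one ]≔ M b))
      + (det N (M [ b ]≔ M b [ one ]≔ M one) + det N (M [ b ]≔ M b [ one ]≔ M b))
      ≈⟨ sym (det-two-rows-+ N M one b (M one) (M b) (λ ())) ⟩
    det N (M [ one ]≔ W [ b ]≔ W)
      ≈⟨ alternating-≥1 (suc (suc n)) IH (M [ one ]≔ W [ b ]≔ W) zero (suc b') (λ ()) (λ q →
           trans (other-row (M [ one ]≔ W) b W one q (λ ())) (trans (replaced-row M one W q)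
                 (sym (replaced-row (M [ one ]≔ W) b W q)))) ⟩
    0# ∎
    where
    N : ℕ
    N = suc (suc (suc n))
    one b : Fin N
    one = suc zero
    b = suc (suc b')
    W : Fin N → Carrier
    W q = M one q + M b q
    -- rows 1 and b of both matrices are equal
    M[b≔1,1≔1]≈0 : det N (M [ b ]≔ M one [ one ]≔ M one) ≈ 0#
    M[b≔1,1≔1]≈0 = alternating-≥1 (suc (suc n)) IH (M [ b ]≔ M one [ one ]≔ M one) zero (suc b') (λ ()) (λ q →
      trans (replaced-row (M [ b ]≔ M one) one (M one) q)
            (sym (trans (other-row (M [ b ]≔ M one) one (M one) b q (λ ())) (replaced-row M b (M one) q))))
    M[b≔b,1≔b]≈0 : det N (M [ b ]≔ M b [ one ]≔ M b) ≈ 0#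
    M[b≔b,1≔b]≈0 = alternating-≥1 (suc (suc n)) IH (M [ b ]≔ M b [ one ]≔ M b) zero (suc b') (λ ()) (λ q →
      trans (replaced-row (M [ b ]≔ M b) one (M b) q)
            (sym (trans (other-row (M [ b ]≔ M b) one (M b) b q (λ ())) (replaced-row M b (M b) q))))
    -- rows 0 and 1 are equal
    M[b≔1,1≔b]≈0 : det N (M [ b ]≔ M one [ one ]≔ M b) ≈ 0#
    M[b≔1,1≔b]≈0 = alternating-01 (suc n) IH (M [ b ]≔ M one [ one ]≔ M b) (λ q →
      trans (other-row (M [ b ]≔ M one) one (M b) zero q (λ ())) (trans (other-row M b (M one) zero q (λ ()))
            (trans (e q) (sym (replaced-row (M [ b ]≔ M one) one (M b) q)))))
    M[b≔b,1≔1]≈M : det N (M [ b ]≔ M b [ one ]≔ M one) ≈ det N M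
    M[b≔b,1≔1]≈M = det-cong N (λ i q →
      trans (replace-cong (M [ b ]≔ M b) one (λ q → sym (other-row M b (M b) one q (λ ()))) i q)
            (trans (replace-self (M [ b ]≔ M b) one i q) (replace-self M b i q)))

  det-alternating : ∀ n → Alternating n
  det-alternating zero M ()
  det-alternating (suc n) M zero zero a≢b e = ⊥-elim (a≢b P.refl)
  det-alternating (suc n) M (suc a) (suc b) a≢b e =
    alternating-≥1 n (det-alternating n) M a b (λ x → a≢b (P.cong suc x)) e
  det-alternating (suc (suc n)) M zero (suc zero) a≢b e = alternating-01 n (det-alternating (suc n)) M e
  det-alternating (suc (suc n)) M (suc zero) zero a≢b e =
    alternating-01 n (det-alternating (suc n)) M (λ q → sym (e q))
  det-alternating (suc (suc (suc n))) M zero (suc (suc b)) a≢b e =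
    alternating-0b n (det-alternating (suc (suc n))) M b e
  det-alternating (suc (suc (suc n))) M (suc (suc a)) zero a≢b e =
    alternating-0b n (det-alternating (suc (suc n))) M a (λ q → sym (e q))

  -- Row operation: replacing row l by Σᵢ cᵢ·(row i) multiplies the
  -- determinant by c_l (the other summands have two equal rows).
  det-row-combination : ∀ n (M : Mat n) l (cf : Fin n → Carrier) →
    det n (M [ l ]≔ (λ q → sum (λ i → cf i * M i q))) ≈ cf l * det n M
  det-row-combination n M l cf = begin
    det n (M [ l ]≔ (λ q → sum (λ i → cf i * M i q))) ≈⟨ det-row-sum n M l n cf M ⟩
    sum (λ i → cf i * det n (M [ l ]≔ M i))           ≈⟨ sum-delta l _ other ⟩
    cf l * det n (M [ l ]≔ M l)                       ≈⟨ *-congˡ (det-cong n (replace-self M l)) ⟩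
    cf l * det n M                                    ∎
    where
    other : ∀ i → i ≢ l → cf i * det n (M [ l ]≔ M i) ≈ 0#
    other i i≢l = trans (*-congˡ (det-alternating n (M [ l ]≔ M i) l i (λ x → i≢l (P.sym x))
      (λ q → trans (replaced-row M l (M i) q) (sym (other-row M l (M i) i q i≢l))))) (zeroʳ _)

  prod : (k : ℕ) → (Fin k → Carrier) → Carrier
  prod zero    f = 1#
  prod (suc k) f = f zero * prod k (f ∘ suc)

  prod-zero : ∀ k (f : Fin k → Carrier) l → f l ≈ 0# → prod k f ≈ 0#
  prod-zero (suc k) f zero    e = trans (*-congʳ e) (zeroˡ _)
  prod-zero (suc k) f (suc l) e = trans (*-congˡ (prod-zero k (f ∘ suc) l e)) (zeroʳ _)

  det-scale-rows : ∀ n (a : Fin n → Carrier) (M : Mat n) → det n (λ i j → a i * M i j) ≈ prod n a * det n M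
  det-scale-rows zero    a M = sym (*-identityʳ _)
  det-scale-rows (suc n) a M = trans
    (sum-cong-≋ {x = λ j → signed (toℕ j) ((a zero * M zero j) * det n (λ p q → a (suc p) * minor M j p q))}
                {y = λ j → signed (toℕ j) (M zero j * ((a zero * prod n (a ∘ suc)) * D j))}
      (λ j → signed-cong (toℕ j) (begin
        (a zero * M zero j) * det n (λ p q → a (suc p) * minor M j p q)
          ≈⟨ *-congˡ (det-scale-rows n (a ∘ suc) (minor M j)) ⟩
        (a zero * M zero j) * (prod n (a ∘ suc) * D j)
          ≈⟨ trans (*-assoc _ _ _) (x∙yz≈y∙xz (a zero) (M zero j) _) ⟩
        M zero j * (a zero * (prod n (a ∘ suc) * D j))
          ≈⟨ *-congˡ (sym (*-assoc _ _ _)) ⟩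
        M zero j * ((a zero * prod n (a ∘ suc)) * D j) ∎)))
    (laplace-* (suc n) (M zero) (a zero * prod n (a ∘ suc)) _ D (λ j → refl))
    where D : Fin (suc n) → Carrier
          D j = det n (minor M j)

  det-zero-column : ∀ n (M : Mat (suc n)) → (∀ p → M p zero ≈ 0#) → det (suc n) M ≈ 0#
  det-zero-column zero    M e = trans (+-identityʳ _) (trans (*-congʳ (e zero)) (zeroˡ _))
  det-zero-column (suc n) M e = sum-0 term
    where
    term : ∀ j → signed (toℕ j) (M zero j * det (suc n) (minor M j)) ≈ 0#
    term zero    = trans (*-congʳ (e zero)) (zeroˡ _)
    term (suc j) = signed-0 (suc (toℕ j))
      (trans (*-congˡ (det-zero-column n (minor M (suc j)) (λ p → e (suc p)))) (zeroʳ _))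

  -- Every minor along row 0 of an upper triangular matrix, except the first,
  -- has a zero first column.
  upper-triangular-off-diagonal : ∀ n (M : Mat (suc n)) → (∀ p q → toℕ q ℕ.< toℕ p → M p q ≈ 0#) →
    sum (λ j → signed (suc (toℕ j)) (M zero (suc j) * det n (minor M (suc j)))) ≈ 0#
  upper-triangular-off-diagonal zero    M e = refl
  upper-triangular-off-diagonal (suc n) M e = sum-0 {suc n} (λ j → signed-0 (suc (toℕ j)) {M zero (suc j) * det (suc n) (minor M (suc j))} (trans (*-congˡ
    (det-zero-column n (minor M (suc j)) (λ p → e (suc p) zero (ℕ.s≤s ℕ.z≤n)))) (zeroʳ _)))

  det-upper-triangular : ∀ n (M : Mat n) → (∀ p q → toℕ q ℕ.< toℕ p → M p q ≈ 0#) →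
                         det n M ≈ prod n (λ i → M i i)
  det-upper-triangular zero    M e = refl
  det-upper-triangular (suc n) M e = begin
    M zero zero * det n (minor M zero) + offDiagonal
      ≈⟨ +-congˡ offDiagonal≈0 ⟩
    M zero zero * det n (minor M zero) + 0#
      ≈⟨ +-identityʳ _ ⟩
    M zero zero * det n (minor M zero)
      ≈⟨ *-congˡ (det-upper-triangular n (minor M zero) (λ p q lt → e (suc p) (suc q) (ℕ.s≤s lt))) ⟩
    M zero zero * prod n (λ i → M (suc i) (suc i)) ∎
    where
    offDiagonal : Carrier
    offDiagonal = sum (λ j → signed (suc (toℕ j)) (M zero (suc j) * det n (minor M (suc j))))
    offDiagonal≈0 : offDiagonal ≈ 0#
    offDiagonal≈0 = upper-triangular-off-diagonal n M e

-- Polynomials over a commutative ring, as coefficient lists (lowest degree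
-- first) up to coefficientwise equality.
module Polynomial {c ℓ} (R : Algebra.Bundles.CommutativeRing c ℓ) where

  open import Algebra.Bundles using (CommutativeRing)
  open import Data.Nat as ℕ using (ℕ; zero; suc)
  import Data.Nat.Properties as NP
  open import Data.Fin as Fin using (Fin; toℕ; punchIn)
  open import Data.List using (List; []; _∷_; map)
  open import Data.Product using (_,_; _×_; proj₁; proj₂)
  open import Data.Empty using (⊥-elim)
  open import Relation.Binary.PropositionalEquality as P using (_≡_; _≢_)
  open import Data.Maybe using (nothing)

  open CommutativeRing R hiding (zero)
  open import Relation.Binary.Reasoning.Setoid setoid
  open import Algebra.Properties.Ring ring using (-0#≈0#)
  open import Algebra.Properties.CommutativeSemigroup *-commutativeSemigroup using (x∙yz≈y∙xz)
  open import Algebra.Properties.CommutativeSemigroup +-commutativeSemigroup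
    using () renaming (interchange to +-interchange; x∙yz≈y∙xz to +-leftSwap)
  open import Tactic.RingSolver.Core.AlmostCommutativeRing using (fromCommutativeRing)
  open import Tactic.RingSolver.NonReflective (fromCommutativeRing R (λ _ → nothing)) using (solve; _⊜_; _⊕_; _⊗_)
  open import Algebra.Properties.CommutativeSemigroup NP.+-commutativeSemigroup
    using () renaming (x∙yz≈y∙xz to ℕ-+-leftSwap)

  Poly : Set c
  Poly = List Carrier

  coeff : Poly → ℕ → Carrier
  coeff []      i       = 0#
  coeff (a ∷ p) zero    = a
  coeff (a ∷ p) (suc i) = coeff p i

  infix 4 _≋_
  record _≋_ (p q : Poly) : Set ℓ where
    constructor mk≋
    field at : ∀ i → coeff p i ≈ coeff q i
  open _≋_ public

  ≋-refl : ∀ {p} → p ≋ p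
  ≋-refl = mk≋ (λ i → refl)
  ≋-sym : ∀ {p q} → p ≋ q → q ≋ p
  ≋-sym e = mk≋ (λ i → sym (at e i))
  ≋-trans : ∀ {p q r} → p ≋ q → q ≋ r → p ≋ r
  ≋-trans e f = mk≋ (λ i → trans (at e i) (at f i))

  infixl 6 _+ᴾ_
  infixl 7 _*ᴾ_
  _+ᴾ_ : Poly → Poly → Poly
  []      +ᴾ q       = q
  (a ∷ p) +ᴾ []      = a ∷ p
  (a ∷ p) +ᴾ (b ∷ q) = (a + b) ∷ (p +ᴾ q)

  -ᴾ_ : Poly → Poly
  -ᴾ p = map -_ p

  scale : Carrier → Poly → Poly
  scale a p = map (a *_) p

  _*ᴾ_ : Poly → Poly → Poly
  []      *ᴾ q = []
  (a ∷ p) *ᴾ q = scale a q +ᴾ (0# ∷ (p *ᴾ q))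

  1ᴾ : Poly
  1ᴾ = 1# ∷ []

  coeff-+ : ∀ p q i → coeff (p +ᴾ q) i ≈ coeff p i + coeff q i
  coeff-+ []      q       i       = sym (+-identityˡ _)
  coeff-+ (a ∷ p) []      i       = sym (+-identityʳ _)
  coeff-+ (a ∷ p) (b ∷ q) zero    = refl
  coeff-+ (a ∷ p) (b ∷ q) (suc i) = coeff-+ p q i

  coeff-neg : ∀ p i → coeff (-ᴾ p) i ≈ - coeff p i
  coeff-neg []      i       = sym -0#≈0#
  coeff-neg (a ∷ p) zero    = refl
  coeff-neg (a ∷ p) (suc i) = coeff-neg p i

  coeff-scale : ∀ a p i → coeff (scale a p) i ≈ a * coeff p i
  coeff-scale a []      i       = sym (zeroʳ a)
  coeff-scale a (b ∷ p) zero    = refl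
  coeff-scale a (b ∷ p) (suc i) = coeff-scale a p i

  +ᴾ-cong : ∀ {p p' q q'} → p ≋ p' → q ≋ q' → p +ᴾ q ≋ p' +ᴾ q'
  +ᴾ-cong {p} {p'} {q} {q'} e f = mk≋ λ i → trans (coeff-+ p q i) (trans (+-cong (at e i) (at f i)) (sym (coeff-+ p' q' i)))

  -ᴾ-cong : ∀ {p p'} → p ≋ p' → -ᴾ p ≋ -ᴾ p'
  -ᴾ-cong {p} {p'} e = mk≋ λ i → trans (coeff-neg p i) (trans (-‿cong (at e i)) (sym (coeff-neg p' i)))

  scale-cong : ∀ {a a' p p'} → a ≈ a' → p ≋ p' → scale a p ≋ scale a' p'
  scale-cong {a} {a'} {p} {p'} e f = mk≋ λ i → trans (coeff-scale a p i) (trans (*-cong e (at f i)) (sym (coeff-scale a' p' i)))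

  cons-cong : ∀ {a a' p p'} → a ≈ a' → p ≋ p' → (a ∷ p) ≋ (a' ∷ p')
  cons-cong e f = mk≋ λ { zero → e ; (suc i) → at f i }

  0∷-≋[] : ∀ {u} → u ≋ [] → (0# ∷ u) ≋ []
  0∷-≋[] e = mk≋ λ { zero → refl ; (suc i) → at e i }

  zero-*ᴾ : ∀ p q → p ≋ [] → p *ᴾ q ≋ []
  zero-*ᴾ []      q e = ≋-refl
  zero-*ᴾ (a ∷ p) q e = mk≋ λ i → begin
    coeff (scale a q +ᴾ (0# ∷ (p *ᴾ q))) i ≈⟨ coeff-+ (scale a q) _ i ⟩
    coeff (scale a q) i + coeff (0# ∷ (p *ᴾ q)) i ≈⟨ +-cong (trans (coeff-scale a q i) (trans (*-congʳ (at e zero)) (zeroˡ _)))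
                                                          (at (0∷-≋[] (zero-*ᴾ p q (mk≋ λ i → at e (suc i)))) i) ⟩
    0# + 0# ≈⟨ +-identityʳ _ ⟩
    0# ∎

  *ᴾ-congˡ : ∀ {p p'} q → p ≋ p' → p *ᴾ q ≋ p' *ᴾ q
  *ᴾ-congˡ {[]}    {[]}      q e = ≋-refl
  *ᴾ-congˡ {[]}    {a' ∷ p'} q e = ≋-sym (zero-*ᴾ (a' ∷ p') q (≋-sym e))
  *ᴾ-congˡ {a ∷ p} {[]}      q e = zero-*ᴾ (a ∷ p) q e
  *ᴾ-congˡ {a ∷ p} {a' ∷ p'} q e = +ᴾ-cong (scale-cong {p = q} (at e zero) ≋-refl) (cons-cong refl (*ᴾ-congˡ {p} {p'} q (mk≋ λ i → at e (suc i))))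

  *ᴾ-congʳ : ∀ p {q q'} → q ≋ q' → p *ᴾ q ≋ p *ᴾ q'
  *ᴾ-congʳ []      e = ≋-refl
  *ᴾ-congʳ (a ∷ p) e = +ᴾ-cong (scale-cong refl e) (cons-cong refl (*ᴾ-congʳ p e))

  *ᴾ-cong : ∀ {p p' q q'} → p ≋ p' → q ≋ q' → p *ᴾ q ≋ p' *ᴾ q'
  *ᴾ-cong {p} {p'} {q} {q'} e f = ≋-trans (*ᴾ-congˡ q e) (*ᴾ-congʳ p' f)

  +ᴾ-assoc : ∀ p q r → (p +ᴾ q) +ᴾ r ≋ p +ᴾ (q +ᴾ r)
  +ᴾ-assoc p q r = mk≋ λ i → begin
    coeff ((p +ᴾ q) +ᴾ r) i ≈⟨ trans (coeff-+ (p +ᴾ q) r i) (+-congʳ (coeff-+ p q i)) ⟩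
    (coeff p i + coeff q i) + coeff r i ≈⟨ +-assoc _ _ _ ⟩
    coeff p i + (coeff q i + coeff r i) ≈⟨ sym (trans (coeff-+ p (q +ᴾ r) i) (+-congˡ (coeff-+ q r i))) ⟩
    coeff (p +ᴾ (q +ᴾ r)) i ∎

  +ᴾ-comm : ∀ p q → p +ᴾ q ≋ q +ᴾ p
  +ᴾ-comm p q = mk≋ λ i → trans (coeff-+ p q i) (trans (+-comm _ _) (sym (coeff-+ q p i)))

  +ᴾ-idʳ : ∀ p → p +ᴾ [] ≋ p
  +ᴾ-idʳ p = mk≋ λ i → trans (coeff-+ p [] i) (+-identityʳ _)

  +ᴾ-invˡ : ∀ p → (-ᴾ p) +ᴾ p ≋ []
  +ᴾ-invˡ p = mk≋ λ i → trans (coeff-+ (-ᴾ p) p i) (trans (+-congʳ (coeff-neg p i)) (-‿inverseˡ _))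

  +ᴾ-invʳ : ∀ p → p +ᴾ (-ᴾ p) ≋ []
  +ᴾ-invʳ p = mk≋ λ i → trans (coeff-+ p (-ᴾ p) i) (trans (+-congˡ (coeff-neg p i)) (-‿inverseʳ _))

  scale-+ : ∀ a p q → scale a (p +ᴾ q) ≋ scale a p +ᴾ scale a q
  scale-+ a p q = mk≋ λ i → trans (coeff-scale a (p +ᴾ q) i) (trans (trans (*-congˡ (coeff-+ p q i)) (distribˡ _ _ _))
                   (sym (trans (coeff-+ (scale a p) (scale a q) i) (+-cong (coeff-scale a p i) (coeff-scale a q i)))))

  scale-scale : ∀ a b p → scale a (scale b p) ≋ scale (a * b) p
  scale-scale a b p = mk≋ λ i → trans (coeff-scale a (scale b p) i) (trans (*-congˡ (coeff-scale b p i)) (trans (sym (*-assoc _ _ _)) (sym (coeff-scale (a * b) p i))))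

  scale-0 : ∀ p → scale 0# p ≋ []
  scale-0 p = mk≋ λ i → trans (coeff-scale 0# p i) (zeroˡ _)

  scale-1 : ∀ p → scale 1# p ≋ p
  scale-1 p = mk≋ λ i → trans (coeff-scale 1# p i) (*-identityˡ _)

  distribʳᴾ : ∀ p q r → (p +ᴾ q) *ᴾ r ≋ p *ᴾ r +ᴾ q *ᴾ r
  distribʳᴾ []      q       r = ≋-refl
  distribʳᴾ (a ∷ p) []      r = ≋-sym (+ᴾ-idʳ _)
  distribʳᴾ (a ∷ p) (b ∷ q) r = mk≋ λ i → begin
    coeff (scale (a + b) r +ᴾ (0# ∷ (p +ᴾ q) *ᴾ r)) i ≈⟨ +ᴾ-cong {scale (a + b) r} {scale a r +ᴾ scale b r}
          (mk≋ λ i → trans (coeff-scale _ r i) (trans (distribʳ _ _ _) (sym (trans (coeff-+ (scale a r) (scale b r) i) (+-cong (coeff-scale a r i) (coeff-scale b r i))))))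
          (cons-cong (sym (+-identityʳ 0#)) (distribʳᴾ p q r)) .at i ⟩
    coeff ((scale a r +ᴾ scale b r) +ᴾ ((0# + 0#) ∷ (p *ᴾ r +ᴾ q *ᴾ r))) i ≈⟨ at lemma i ⟩
    coeff ((scale a r +ᴾ (0# ∷ (p *ᴾ r))) +ᴾ (scale b r +ᴾ (0# ∷ (q *ᴾ r)))) i ∎
    where
    lemma : (scale a r +ᴾ scale b r) +ᴾ ((0# + 0#) ∷ (p *ᴾ r +ᴾ q *ᴾ r)) ≋ (scale a r +ᴾ (0# ∷ (p *ᴾ r))) +ᴾ (scale b r +ᴾ (0# ∷ (q *ᴾ r)))
    lemma = mk≋ λ i → begin
      coeff ((scale a r +ᴾ scale b r) +ᴾ ((0# + 0#) ∷ (p *ᴾ r +ᴾ q *ᴾ r))) i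
        ≈⟨ trans (coeff-+ (scale a r +ᴾ scale b r) _ i) (+-cong (coeff-+ (scale a r) (scale b r) i) (coeff-+ (0# ∷ (p *ᴾ r)) (0# ∷ (q *ᴾ r)) i)) ⟩
      (coeff (scale a r) i + coeff (scale b r) i) + (coeff (0# ∷ (p *ᴾ r)) i + coeff (0# ∷ (q *ᴾ r)) i)
        ≈⟨ +-interchange _ _ _ _ ⟩
      (coeff (scale a r) i + coeff (0# ∷ (p *ᴾ r)) i) + (coeff (scale b r) i + coeff (0# ∷ (q *ᴾ r)) i)
        ≈⟨ sym (trans (coeff-+ (scale a r +ᴾ (0# ∷ (p *ᴾ r))) _ i) (+-cong (coeff-+ (scale a r) _ i) (coeff-+ (scale b r) _ i))) ⟩
      coeff ((scale a r +ᴾ (0# ∷ (p *ᴾ r))) +ᴾ (scale b r +ᴾ (0# ∷ (q *ᴾ r)))) i ∎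

  +ᴾ-interchange : ∀ A B C D → (A +ᴾ B) +ᴾ (C +ᴾ D) ≋ (A +ᴾ C) +ᴾ (B +ᴾ D)
  +ᴾ-interchange A B C D = mk≋ λ i → begin
    coeff ((A +ᴾ B) +ᴾ (C +ᴾ D)) i ≈⟨ trans (coeff-+ (A +ᴾ B) _ i) (+-cong (coeff-+ A B i) (coeff-+ C D i)) ⟩
    (coeff A i + coeff B i) + (coeff C i + coeff D i)
        ≈⟨ +-interchange _ _ _ _ ⟩
    (coeff A i + coeff C i) + (coeff B i + coeff D i) ≈⟨ sym (trans (coeff-+ (A +ᴾ C) _ i) (+-cong (coeff-+ A C i) (coeff-+ B D i))) ⟩
    coeff ((A +ᴾ C) +ᴾ (B +ᴾ D)) i ∎

  +ᴾ-leftSwap : ∀ A B C → A +ᴾ (B +ᴾ C) ≋ B +ᴾ (A +ᴾ C)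
  +ᴾ-leftSwap A B C = mk≋ λ i → begin
    coeff (A +ᴾ (B +ᴾ C)) i ≈⟨ trans (coeff-+ A _ i) (+-congˡ (coeff-+ B C i)) ⟩
    coeff A i + (coeff B i + coeff C i) ≈⟨ +-leftSwap _ _ _ ⟩
    coeff B i + (coeff A i + coeff C i) ≈⟨ sym (trans (coeff-+ B _ i) (+-congˡ (coeff-+ A C i))) ⟩
    coeff (B +ᴾ (A +ᴾ C)) i ∎

  distribˡᴾ : ∀ r p q → r *ᴾ (p +ᴾ q) ≋ r *ᴾ p +ᴾ r *ᴾ q
  distribˡᴾ []      p q = ≋-refl
  distribˡᴾ (a ∷ r) p q = ≋-trans (+ᴾ-cong (scale-+ a p q) (cons-cong (sym (+-identityʳ 0#)) (distribˡᴾ r p q)))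
                                  (+ᴾ-interchange (scale a p) (scale a q) (0# ∷ (r *ᴾ p)) (0# ∷ (r *ᴾ q)))

  *ᴾ-[] : ∀ p → p *ᴾ [] ≋ []
  *ᴾ-[] []      = ≋-refl
  *ᴾ-[] (a ∷ p) = 0∷-≋[] (*ᴾ-[] p)

  *ᴾ-cons : ∀ p b q → p *ᴾ (b ∷ q) ≋ scale b p +ᴾ (0# ∷ (p *ᴾ q))
  *ᴾ-cons []      b q = mk≋ λ { zero → refl ; (suc i) → refl }
  *ᴾ-cons (a ∷ p) b q = cons-cong (+-congʳ (*-comm a b))
    (≋-trans (+ᴾ-cong (≋-refl {scale a q}) (*ᴾ-cons p b q)) (+ᴾ-leftSwap (scale a q) (scale b p) (0# ∷ (p *ᴾ q))))

  *ᴾ-comm : ∀ p q → p *ᴾ q ≋ q *ᴾ p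
  *ᴾ-comm []      q = ≋-sym (*ᴾ-[] q)
  *ᴾ-comm (a ∷ p) q = ≋-trans (+ᴾ-cong (≋-refl {scale a q}) (cons-cong refl (*ᴾ-comm p q))) (≋-sym (*ᴾ-cons q a p))

  scale-*ᴾ : ∀ a q r → (scale a q) *ᴾ r ≋ scale a (q *ᴾ r)
  scale-*ᴾ a []      r = ≋-refl
  scale-*ᴾ a (b ∷ q) r = ≋-trans (+ᴾ-cong (≋-sym (scale-scale a b r)) (cons-cong (sym (zeroʳ a)) (scale-*ᴾ a q r)))
                               (≋-sym (scale-+ a (scale b r) (0# ∷ (q *ᴾ r))))

  *ᴾ-assoc : ∀ p q r → (p *ᴾ q) *ᴾ r ≋ p *ᴾ (q *ᴾ r)
  *ᴾ-assoc []      q r = ≋-refl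
  *ᴾ-assoc (a ∷ p) q r = ≋-trans (distribʳᴾ (scale a q) (0# ∷ (p *ᴾ q)) r)
    (+ᴾ-cong (scale-*ᴾ a q r) (≋-trans (+ᴾ-cong (scale-0 r) (≋-refl {0# ∷ ((p *ᴾ q) *ᴾ r)})) (cons-cong refl (*ᴾ-assoc p q r))))

  *ᴾ-idˡ : ∀ q → 1ᴾ *ᴾ q ≋ q
  *ᴾ-idˡ q = ≋-trans (+ᴾ-cong (scale-1 q) (0∷-≋[] (≋-refl {[]}))) (+ᴾ-idʳ q)

  *ᴾ-idʳ : ∀ q → q *ᴾ 1ᴾ ≋ q
  *ᴾ-idʳ q = ≋-trans (*ᴾ-comm q 1ᴾ) (*ᴾ-idˡ q)

  PolyRing : CommutativeRing c ℓ
  PolyRing = record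
    { Carrier = Poly ; _≈_ = _≋_ ; _+_ = _+ᴾ_ ; _*_ = _*ᴾ_ ; -_ = -ᴾ_ ; 0# = [] ; 1# = 1ᴾ
    ; isCommutativeRing = record
      { isRing = record
        { +-isAbelianGroup = record
          { isGroup = record
            { isMonoid = record
              { isSemigroup = record
                { isMagma = record
                  { isEquivalence = record { refl = ≋-refl ; sym = ≋-sym ; trans = ≋-trans }
                  ; ∙-cong = +ᴾ-cong }
                ; assoc = +ᴾ-assoc }
              ; identity = (λ p → ≋-refl) , +ᴾ-idʳ }
            ; inverse = +ᴾ-invˡ , +ᴾ-invʳ
            ; ⁻¹-cong = -ᴾ-cong }
          ; comm = +ᴾ-comm }
        ; *-cong = *ᴾ-cong
        ; *-assoc = *ᴾ-assoc
        ; *-identity = *ᴾ-idˡ , *ᴾ-idʳ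
        ; distrib = distribˡᴾ , (λ x y z → distribʳᴾ y z x) }
      ; *-comm = *ᴾ-comm } }

  module DetF = Determinant R
  module DetP = Determinant PolyRing

  power : Carrier → ℕ → Carrier
  power t zero    = 1#
  power t (suc k) = t * power t k

  eval : Poly → Carrier → Carrier
  eval []      t = 0#
  eval (a ∷ p) t = a + t * eval p t

  eval-+ : ∀ p q t → eval (p +ᴾ q) t ≈ eval p t + eval q t
  eval-+ []      q       t = sym (+-identityˡ _)
  eval-+ (a ∷ p) []      t = sym (+-identityʳ _)
  eval-+ (a ∷ p) (b ∷ q) t = begin
    (a + b) + t * eval (p +ᴾ q) t ≈⟨ +-congˡ (*-congˡ (eval-+ p q t)) ⟩
    (a + b) + t * (eval p t + eval q t)
      ≈⟨ solve 5 (λ a b t x y → ((a ⊕ b) ⊕ (t ⊗ (x ⊕ y))) ⊜ ((a ⊕ (t ⊗ x)) ⊕ (b ⊕ (t ⊗ y)))) refl a b t _ _ ⟩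
    (a + t * eval p t) + (b + t * eval q t) ∎

  eval-scale : ∀ a p t → eval (scale a p) t ≈ a * eval p t
  eval-scale a []      t = sym (zeroʳ a)
  eval-scale a (b ∷ p) t = begin
    a * b + t * eval (scale a p) t ≈⟨ +-congˡ (*-congˡ (eval-scale a p t)) ⟩
    a * b + t * (a * eval p t) ≈⟨ solve 4 (λ a b t x → ((a ⊗ b) ⊕ (t ⊗ (a ⊗ x))) ⊜ (a ⊗ (b ⊕ (t ⊗ x)))) refl a b t _ ⟩
    a * (b + t * eval p t) ∎

  eval-* : ∀ p q t → eval (p *ᴾ q) t ≈ eval p t * eval q t
  eval-* []      q t = sym (zeroˡ _)
  eval-* (a ∷ p) q t = begin
    eval (scale a q +ᴾ (0# ∷ (p *ᴾ q))) t ≈⟨ eval-+ (scale a q) _ t ⟩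
    eval (scale a q) t + (0# + t * eval (p *ᴾ q) t) ≈⟨ +-cong (eval-scale a q t) (trans (+-identityˡ _) (*-congˡ (eval-* p q t))) ⟩
    a * eval q t + t * (eval p t * eval q t) ≈⟨ solve 4 (λ a y t x → ((a ⊗ y) ⊕ (t ⊗ (x ⊗ y))) ⊜ ((a ⊕ (t ⊗ x)) ⊗ y)) refl a _ t _ ⟩
    (a + t * eval p t) * eval q t ∎

  eval-0 : ∀ p t → p ≋ [] → eval p t ≈ 0#
  eval-0 []      t e = refl
  eval-0 (a ∷ p) t e = trans (+-cong (at e zero) (trans (*-congˡ (eval-0 p t (mk≋ λ i → at e (suc i)))) (zeroʳ t))) (+-identityʳ _)

  eval-cong : ∀ {p q} t → p ≋ q → eval p t ≈ eval q t
  eval-cong {[]}    {q}     t e = sym (eval-0 q t (≋-sym e))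
  eval-cong {a ∷ p} {[]}    t e = eval-0 (a ∷ p) t e
  eval-cong {a ∷ p} {b ∷ q} t e = +-cong (at e zero) (*-congˡ (eval-cong {p} {q} t (mk≋ λ i → at e (suc i))))

  const : Carrier → Poly
  const a = a ∷ []

  const-*ᴾ : ∀ a p → const a *ᴾ p ≋ scale a p
  const-*ᴾ a p = ≋-trans (+ᴾ-cong (≋-refl {scale a p}) (0∷-≋[] (≋-refl {[]}))) (+ᴾ-idʳ _)

  eval-const : ∀ a t → eval (const a) t ≈ a
  eval-const a t = trans (+-congˡ (zeroʳ t)) (+-identityʳ a)

  eval-const-*ᴾ : ∀ a p t → eval (const a *ᴾ p) t ≈ a * eval p t
  eval-const-*ᴾ a p t = trans (eval-* (const a) p t) (*-congʳ (eval-const a t))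

  eval-sum : ∀ n (f : Fin n → Poly) t → eval (DetP.sum {n} f) t ≈ DetF.sum {n} (λ i → eval (f i) t)
  eval-sum zero    f t = refl
  eval-sum (suc n) f t = trans (eval-+ (f Fin.zero) _ t) (+-congˡ (eval-sum n (λ i → f (Fin.suc i)) t))

  mono : ℕ → Carrier → Poly
  mono zero    a = a ∷ []
  mono (suc k) a = 0# ∷ mono k a

  eval-mono : ∀ k a t → eval (mono k a) t ≈ a * power t k
  eval-mono zero    a t = trans (+-congˡ (zeroʳ t)) (trans (+-identityʳ a) (sym (*-identityʳ a)))
  eval-mono (suc k) a t = trans (+-identityˡ _) (trans (*-congˡ (eval-mono k a t)) (x∙yz≈y∙xz t a _))

  coeff-mono-same : ∀ k a → coeff (mono k a) k ≡ a
  coeff-mono-same zero    a = P.refl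
  coeff-mono-same (suc k) a = coeff-mono-same k a

  coeff-mono-other : ∀ k a i → i ≢ k → coeff (mono k a) i ≈ 0#
  coeff-mono-other zero    a zero    ne = ⊥-elim (ne P.refl)
  coeff-mono-other zero    a (suc i) ne = refl
  coeff-mono-other (suc k) a zero    ne = refl
  coeff-mono-other (suc k) a (suc i) ne = coeff-mono-other k a i (λ e → ne (P.cong suc e))

  scale-mono : ∀ a k b → scale a (mono k b) ≋ mono k (a * b)
  scale-mono a zero    b = ≋-refl
  scale-mono a (suc k) b = cons-cong (zeroʳ a) (scale-mono a k b)

  mono-cong : ∀ k {a b} → a ≈ b → mono k a ≋ mono k b
  mono-cong zero    e = cons-cong e ≋-refl
  mono-cong (suc k) e = cons-cong refl (mono-cong k e)

  mono-zero : ∀ k {a} → a ≈ 0# → mono k a ≋ []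
  mono-zero zero    e = mk≋ λ { zero → e ; (suc i) → refl }
  mono-zero (suc k) e = 0∷-≋[] (mono-zero k e)

  mono-mul : ∀ j a k b → mono j a *ᴾ mono k b ≋ mono (j ℕ.+ k) (a * b)
  mono-mul zero    a k b = ≋-trans (+ᴾ-cong (scale-mono a k b) (0∷-≋[] (≋-refl {[]}))) (+ᴾ-idʳ _)
  mono-mul (suc j) a k b = ≋-trans (+ᴾ-cong (scale-0 (mono k b)) (≋-refl {0# ∷ (mono j a *ᴾ mono k b)})) (cons-cong refl (mono-mul j a k b))

  Deg≤ : Poly → ℕ → Set ℓ
  Deg≤ p D = ∀ i → D ℕ.< i → coeff p i ≈ 0#

  Deg≤-+ : ∀ {p q D} → Deg≤ p D → Deg≤ q D → Deg≤ (p +ᴾ q) D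
  Deg≤-+ {p} {q} dp dq i lt = trans (coeff-+ p q i) (trans (+-cong (dp i lt) (dq i lt)) (+-identityʳ _))

  Deg≤-neg : ∀ {p D} → Deg≤ p D → Deg≤ (-ᴾ p) D
  Deg≤-neg {p} dp i lt = trans (coeff-neg p i) (trans (-‿cong (dp i lt)) -0#≈0#)

  Deg≤-cong : ∀ {p q D} → p ≋ q → Deg≤ p D → Deg≤ q D
  Deg≤-cong e dp i lt = trans (sym (at e i)) (dp i lt)

  Deg≤-mono : ∀ k a D → k ℕ.≤ D → Deg≤ (mono k a) D
  Deg≤-mono k a D le i lt = coeff-mono-other k a i (λ e → NP.<-irrefl (P.sym e) (NP.≤-<-trans le lt))

  Deg≤-[] : ∀ D → Deg≤ [] D
  Deg≤-[] D i lt = refl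

  Deg≤-signed : ∀ k {p D} → Deg≤ p D → Deg≤ (DetP.signed k p) D
  Deg≤-signed zero    dp = dp
  Deg≤-signed (suc k) {p} dp = Deg≤-neg {DetP.signed k p} (Deg≤-signed k dp)

  Deg≤-sum : ∀ n (f : Fin n → Poly) D → (∀ j → Deg≤ (f j) D) → Deg≤ (DetP.sum {n} f) D
  Deg≤-sum zero    f D df = Deg≤-[] D
  Deg≤-sum (suc n) f D df = Deg≤-+ {f Fin.zero} {DetP.sum {n} (λ j → f (Fin.suc j))} (df Fin.zero) (Deg≤-sum n (λ j → f (Fin.suc j)) D (λ j → df (Fin.suc j)))

  coeff-signed : ∀ k p i → coeff (DetP.signed k p) i ≈ DetF.signed k (coeff p i)
  coeff-signed zero    p i = refl
  coeff-signed (suc k) p i = trans (coeff-neg (DetP.signed k p) i) (-‿cong (coeff-signed k p i))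

  coeff-sum : ∀ n (f : Fin n → Poly) i → coeff (DetP.sum {n} f) i ≈ DetF.sum {n} (λ j → coeff (f j) i)
  coeff-sum zero    f i = refl
  coeff-sum (suc n) f i = trans (coeff-+ (f Fin.zero) _ i) (+-congˡ (coeff-sum n (λ j → f (Fin.suc j)) i))

  Deg≤-* : ∀ p q a b → Deg≤ p a → Deg≤ q b → Deg≤ (p *ᴾ q) (a ℕ.+ b) × (coeff (p *ᴾ q) (a ℕ.+ b) ≈ coeff p a * coeff q b)
  Deg≤-* []      q a b dp dq = (λ i lt → refl) , sym (zeroˡ _)
  Deg≤-* (c ∷ p) q zero b dp dq = dg , cb
    where
    p0 : p ≋ []
    p0 = mk≋ λ i → dp (suc i) (ℕ.s≤s ℕ.z≤n)
    pq0 : ∀ i → coeff (p *ᴾ q) i ≈ 0#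
    pq0 i = at (zero-*ᴾ p q p0) i
    dg : Deg≤ ((c ∷ p) *ᴾ q) b
    dg zero lt = trans (coeff-+ (scale c q) _ zero) (trans (+-cong (trans (coeff-scale c q zero) (trans (*-congˡ (dq zero lt)) (zeroʳ c))) refl) (+-identityʳ _))
    dg (suc i) lt = trans (coeff-+ (scale c q) _ (suc i)) (trans (+-cong (trans (coeff-scale c q (suc i)) (trans (*-congˡ (dq (suc i) lt)) (zeroʳ c))) (pq0 i)) (+-identityʳ _))
    top' : ∀ b → coeff ((c ∷ p) *ᴾ q) b ≈ c * coeff q b
    top' zero     = trans (coeff-+ (scale c q) _ zero) (trans (+-identityʳ _) (coeff-scale c q zero))
    top' (suc b') = trans (coeff-+ (scale c q) _ (suc b')) (trans (+-cong (coeff-scale c q (suc b')) (pq0 b')) (+-identityʳ _))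
    cb : coeff ((c ∷ p) *ᴾ q) b ≈ c * coeff q b
    cb = top' b
  Deg≤-* (c ∷ p) q (suc a) b dp dq = dg , cb
    where
    ih : Deg≤ (p *ᴾ q) (a ℕ.+ b) × (coeff (p *ᴾ q) (a ℕ.+ b) ≈ coeff p a * coeff q b)
    ih = Deg≤-* p q a b (λ i lt → dp (suc i) (ℕ.s≤s lt)) dq
    dg : Deg≤ ((c ∷ p) *ᴾ q) (suc a ℕ.+ b)
    dg zero ()
    dg (suc i) (ℕ.s≤s lt) = trans (coeff-+ (scale c q) _ (suc i))
      (trans (+-cong (trans (coeff-scale c q (suc i)) (trans (*-congˡ (dq (suc i) (ℕ.s≤s (NP.≤-trans (NP.m≤n+m b a) (NP.<⇒≤ lt))))) (zeroʳ c)))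
                     (proj₁ ih i lt)) (+-identityʳ _))
    cb : coeff ((c ∷ p) *ᴾ q) (suc a ℕ.+ b) ≈ coeff p a * coeff q b
    cb = trans (coeff-+ (scale c q) _ (suc (a ℕ.+ b)))
      (trans (+-cong (trans (coeff-scale c q (suc (a ℕ.+ b))) (trans (*-congˡ (dq (suc (a ℕ.+ b)) (ℕ.s≤s (NP.m≤n+m b a)))) (zeroʳ c))) (proj₂ ih))
             (+-identityˡ _))

  sumℕ-remove : ∀ n (β : Fin (suc n) → ℕ) j → Defs.sumℕ (suc n) β ≡ β j ℕ.+ Defs.sumℕ n (λ q → β (punchIn j q))
  sumℕ-remove n       β Fin.zero    = P.refl
  sumℕ-remove (suc n) β (Fin.suc j) = P.trans (P.cong (β Fin.zero ℕ.+_) (sumℕ-remove n (λ q → β (Fin.suc q)) j))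
    (ℕ-+-leftSwap (β Fin.zero) (β (Fin.suc j)) (Defs.sumℕ n (λ q → β (Fin.suc (punchIn j q)))))

  Deg≤-subst : ∀ {p a b} → a ≡ b → Deg≤ p a → Deg≤ p b
  Deg≤-subst P.refl d = d

  det-degree : ∀ n (M : Fin n → Fin n → Poly) (β : Fin n → ℕ) → (∀ i j → Deg≤ (M i j) (β j)) →
    Deg≤ (DetP.det n M) (Defs.sumℕ n β) ×
    (coeff (DetP.det n M) (Defs.sumℕ n β) ≈ DetF.det n (λ i j → coeff (M i j) (β j)))
  det-degree zero M β dm = (λ { zero () ; (suc i) lt → refl }) , refl
  det-degree (suc n) M β dm = Deg≤-sum (suc n) T S degT , trans (coeff-sum (suc n) T S) (DetF.sum-cong-≋ coeffT)
    where
    S : ℕ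
    S = Defs.sumℕ (suc n) β
    βj : Fin (suc n) → Fin n → ℕ
    βj j q = β (punchIn j q)
    T : Fin (suc n) → Poly
    T j = DetP.signed (toℕ j) (M Fin.zero j *ᴾ DetP.det n (DetP.minor M j))
    minorDegree : ∀ j → Deg≤ (DetP.det n (DetP.minor M j)) (Defs.sumℕ n (βj j)) ×
      (coeff (DetP.det n (DetP.minor M j)) (Defs.sumℕ n (βj j)) ≈ DetF.det n (λ p q → coeff (DetP.minor M j p q) (βj j q)))
    minorDegree j = det-degree n (DetP.minor M j) (βj j) (λ p q → dm (Fin.suc p) (punchIn j q))
    termDegree : ∀ j → Deg≤ (M Fin.zero j *ᴾ DetP.det n (DetP.minor M j)) (β j ℕ.+ Defs.sumℕ n (βj j)) ×
      (coeff (M Fin.zero j *ᴾ DetP.det n (DetP.minor M j)) (β j ℕ.+ Defs.sumℕ n (βj j))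
        ≈ coeff (M Fin.zero j) (β j) * coeff (DetP.det n (DetP.minor M j)) (Defs.sumℕ n (βj j)))
    termDegree j = Deg≤-* (M Fin.zero j) _ (β j) _ (dm Fin.zero j) (proj₁ (minorDegree j))
    degT : ∀ j → Deg≤ (T j) S
    degT j = Deg≤-signed (toℕ j) {M Fin.zero j *ᴾ DetP.det n (DetP.minor M j)}
               (Deg≤-subst {M Fin.zero j *ᴾ DetP.det n (DetP.minor M j)} (P.sym (sumℕ-remove n β j)) (proj₁ (termDegree j)))
    coeffT : ∀ j → coeff (T j) S ≈ DetF.signed (toℕ j)
               (coeff (M Fin.zero j) (β j) * DetF.det n (λ p q → coeff (DetP.minor M j p q) (βj j q)))
    coeffT j = trans (coeff-signed (toℕ j) _ S) (DetF.signed-cong (toℕ j)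
      (trans (reflexive (P.cong (coeff (M Fin.zero j *ᴾ DetP.det n (DetP.minor M j))) (sumℕ-remove n β j)))
             (trans (proj₂ (termDegree j)) (*-congˡ (proj₂ (minorDegree j))))))

-- The main
-- result, multiplicity-bound, says that if (X - tₗ)^kₗ divides a polynomial
-- of exact degree D for pairwise distinct tₗ, then Σ kₗ ≤ D.  It rests on
-- two facts: each factor X - t lowers the exact degree by one (Deg≡-X-^*),
-- and powers of X - a and X - b are coprime for a ≠ b (coprime-powers).
module RootMultiplicity {c ℓ} (F : Defs.Field c ℓ) where

  open import Data.Nat as ℕ using (ℕ; zero; suc; _∸_)
  import Data.Nat.Properties as NP
  open import Data.List using ([]; _∷_; length)
  open import Data.Product using (_,_; Σ; _×_; proj₁; proj₂)
  open import Data.Fin as Fin using (Fin)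
  open import Data.Fin.Properties using (0≢1+n; suc-injective)
  open import Relation.Binary.PropositionalEquality as P using (_≡_)
  open import Relation.Nullary using (¬_)
  open import Data.Empty using (⊥-elim)
  open import Algebra.Bundles using (CommutativeRing)
  open import Level using (_⊔_)

  R : CommutativeRing c ℓ
  R = Defs.Field.commutativeRing F
  open Defs.Field F using (inverse)
  open CommutativeRing R hiding (zero)
  open import Relation.Binary.Reasoning.Setoid setoid
  open import Algebra.Properties.Ring ring using (-‿distribˡ-*; -0#≈0#; x∙y⁻¹≈ε⇒x≈y)
  open Polynomial R public
  open import Algebra.Properties.Ring (CommutativeRing.ring PolyRing) as PR using ()

  X- : Carrier → Poly
  X- a = (- a) ∷ 1# ∷ []

  infixr 8 _^ᴾ_
  _^ᴾ_ : Poly → ℕ → Poly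
  p ^ᴾ zero    = 1ᴾ
  p ^ᴾ (suc k) = p *ᴾ p ^ᴾ k

  const-inv : ∀ a u → a * u ≈ 1# → const u *ᴾ const a ≋ 1ᴾ
  const-inv a u au = ≋-trans (const-*ᴾ u (const a)) (cons-cong (trans (*-comm u a) au) ≋-refl)

  coeff-X-* : ∀ a q i → coeff (X- a *ᴾ q) (suc i) ≈ coeff q i + - (a * coeff q (suc i))
  coeff-X-* a q i = begin
    coeff (scale (- a) q +ᴾ (0# ∷ (scale 1# q +ᴾ (0# ∷ [])))) (suc i)
      ≈⟨ coeff-+ (scale (- a) q) _ (suc i) ⟩
    coeff (scale (- a) q) (suc i) + coeff (scale 1# q +ᴾ (0# ∷ [])) i
      ≈⟨ +-cong (coeff-scale (- a) q (suc i)) (at (+ᴾ-cong (scale-1 q) (0∷-≋[] (≋-refl {[]}))) i) ⟩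
    - a * coeff q (suc i) + coeff (q +ᴾ []) i
      ≈⟨ +-cong (sym (-‿distribˡ-* _ _)) (at (+ᴾ-idʳ q) i) ⟩
    - (a * coeff q (suc i)) + coeff q i
      ≈⟨ +-comm _ _ ⟩
    coeff q i + - (a * coeff q (suc i)) ∎

  coeff₀-X-* : ∀ a q → coeff (X- a *ᴾ q) zero ≈ - a * coeff q zero
  coeff₀-X-* a q = trans (coeff-+ (scale (- a) q) _ zero) (trans (+-identityʳ _) (coeff-scale (- a) q zero))

  coeff-recurrence : ∀ a q i → coeff (X- a *ᴾ q) (suc i) ≈ 0# → coeff q i ≈ a * coeff q (suc i)
  coeff-recurrence a q i e = x∙y⁻¹≈ε⇒x≈y _ _ (trans (sym (coeff-X-* a q i)) e)

  -- Synthetic division: p = p(t) + (X - t)·quot t p.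
  quot : Carrier → Poly → Poly
  quot t []      = []
  quot t (a ∷ p) = eval p t ∷ quot t p

  factor : ∀ t p → p ≋ const (eval p t) +ᴾ X- t *ᴾ quot t p
  factor t p = mk≋ (go p)
    where
    go : ∀ p i → coeff p i ≈ coeff (const (eval p t) +ᴾ X- t *ᴾ quot t p) i
    go []      zero    = sym (trans (coeff-+ (const 0#) (X- t *ᴾ []) zero)
      (trans (+-identityˡ _) (trans (coeff₀-X-* t []) (zeroʳ _))))
    go []      (suc i) = sym (trans (coeff-+ (const 0#) (X- t *ᴾ []) (suc i))
      (trans (+-identityˡ _) (trans (coeff-X-* t [] i) (trans (+-identityˡ _) (trans (-‿cong (zeroʳ t)) -0#≈0#)))))
    go (a ∷ p) zero    = sym (trans (coeff-+ (const (eval (a ∷ p) t)) (X- t *ᴾ quot t (a ∷ p)) zero)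
      (trans (+-congˡ (coeff₀-X-* t (quot t (a ∷ p))))
      (trans (+-congˡ (sym (-‿distribˡ-* t _)))
      (trans (+-assoc _ _ _) (trans (+-congˡ (-‿inverseʳ _)) (+-identityʳ a))))))
    go (a ∷ p) (suc i) = trans (go p i) (trans (coeff-+ (const (eval p t)) (X- t *ᴾ quot t p) i)
      (sym (trans (coeff-+ (const (eval (a ∷ p) t)) (X- t *ᴾ quot t (a ∷ p)) (suc i))
      (trans (+-identityˡ _) (trans (coeff-X-* t (quot t (a ∷ p)) i) (shift i))))))
      where
      shift : ∀ i → coeff (quot t (a ∷ p)) i + - (t * coeff (quot t (a ∷ p)) (suc i))
                  ≈ coeff (const (eval p t)) i + coeff (X- t *ᴾ quot t p) i
      shift zero    = +-congˡ (trans (-‿distribˡ-* t _) (sym (coeff₀-X-* t (quot t p))))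
      shift (suc i) = trans (sym (coeff-X-* t (quot t p) i)) (sym (+-identityˡ _))

  root-factor : ∀ t p → eval p t ≈ 0# → p ≋ X- t *ᴾ quot t p
  root-factor t p e = ≋-trans (factor t p)
    (+ᴾ-cong {const (eval p t)} {[]} {X- t *ᴾ quot t p} {X- t *ᴾ quot t p} (mk≋ λ { zero → e ; (suc i) → refl }) ≋-refl)

  coeff-beyond-length : ∀ q j → length q ℕ.≤ j → coeff q j ≡ 0#
  coeff-beyond-length []      j       le = P.refl
  coeff-beyond-length (a ∷ q) (suc j) (ℕ.s≤s le) = coeff-beyond-length q j le

  -- If q_i = a·q_{i+1} for all i ≥ D, then q vanishes from D on, since q has
  -- only finitely many nonzero coefficients.
  coeff-vanish : ∀ (q : Poly) a D → (∀ i → D ℕ.≤ i → coeff q i ≈ a * coeff q (suc i)) →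
                 ∀ i → D ℕ.≤ i → coeff q i ≈ 0#
  coeff-vanish q a D rec i D≤i = go (length q) i D≤i (NP.m≤n+m (length q) i)
    where
    go : ∀ k i → D ℕ.≤ i → length q ℕ.≤ i ℕ.+ k → coeff q i ≈ 0#
    go zero    i D≤i end = reflexive (coeff-beyond-length q i (P.subst (length q ℕ.≤_) (NP.+-identityʳ i) end))
    go (suc k) i D≤i end = trans (rec i D≤i) (trans (*-congˡ
      (go k (suc i) (NP.m≤n⇒m≤1+n D≤i) (P.subst (length q ℕ.≤_) (NP.+-suc i k) end))) (zeroʳ a))

  Deg≡ : Poly → ℕ → Set ℓ
  Deg≡ p D = Deg≤ p D × (¬ (coeff p D ≈ 0#))

  Deg≡-cong : ∀ {p q D} → p ≋ q → Deg≡ p D → Deg≡ q D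
  Deg≡-cong e (d , nz) = Deg≤-cong e d , (λ z → nz (trans (at e _) z))

  Deg≡-X-* : ∀ a q D → Deg≡ (X- a *ᴾ q) D → Σ ℕ λ D' → (D ≡ suc D') × Deg≡ q D'
  Deg≡-X-* a q D (d , nz) = go D P.refl d nz
    where
    q-vanishes : ∀ i → D ℕ.≤ i → coeff q i ≈ 0#
    q-vanishes = coeff-vanish q a D (λ i le → coeff-recurrence a q i (d (suc i) (ℕ.s≤s le)))
    go : ∀ D' → D' ≡ D → Deg≤ (X- a *ᴾ q) D' → ¬ (coeff (X- a *ᴾ q) D' ≈ 0#) → Σ ℕ λ D'' → (D ≡ suc D'') × Deg≡ q D''
    go zero    e d nz = ⊥-elim (nz (trans (coeff₀-X-* a q) (trans (*-congˡ (q-vanishes zero (P.subst (ℕ._≤ 0) e ℕ.z≤n))) (zeroʳ _))))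
    go (suc D') P.refl d nz = D' , P.refl , (λ i lt → q-vanishes i lt) ,
      (λ z → nz (trans (coeff-X-* a q D') (trans (+-cong z (trans (-‿cong (trans (*-congˡ (q-vanishes (suc D') NP.≤-refl)) (zeroʳ a))) -0#≈0#)) (+-identityʳ _))))

  Deg≡-X-^* : ∀ a k q D → Deg≡ (X- a ^ᴾ k *ᴾ q) D → (k ℕ.≤ D) × Deg≡ q (D ∸ k)
  Deg≡-X-^* a zero    q D ex = ℕ.z≤n , Deg≡-cong (*ᴾ-idˡ q) ex
  Deg≡-X-^* a (suc k) q D ex with Deg≡-X-* a (X- a ^ᴾ k *ᴾ q) D (Deg≡-cong (*ᴾ-assoc (X- a) (X- a ^ᴾ k) q) ex)
  ... | D' , P.refl , ex' = let r = Deg≡-X-^* a k q D' ex' in ℕ.s≤s (proj₁ r) , proj₂ r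

  -- X^e = (X - 0)^e, so division by X^e lowers the exact degree by e.
  X-0≋X : X- 0# ≋ mono 1 1#
  X-0≋X = cons-cong -0#≈0# ≋-refl

  X^≋X-0^ : ∀ e → mono e 1# ≋ X- 0# ^ᴾ e
  X^≋X-0^ zero    = ≋-refl
  X^≋X-0^ (suc e) = ≋-trans (≋-trans (mono-cong (suc e) (sym (*-identityˡ 1#))) (≋-sym (mono-mul 1 1# e 1#)))
                             (*ᴾ-cong (≋-sym X-0≋X) (X^≋X-0^ e))

  Deg≡-X^* : ∀ e q D → Deg≡ (mono e 1# *ᴾ q) D → (e ℕ.≤ D) × Deg≡ q (D ∸ e)
  Deg≡-X^* e q D ex = Deg≡-X-^* 0# e q D (Deg≡-cong (*ᴾ-congˡ q (X^≋X-0^ e)) ex)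

  X-*-zero : ∀ b D → X- b *ᴾ D ≋ [] → D ≋ []
  X-*-zero b D e = mk≋ λ i → coeff-vanish D b 0 (λ i _ → coeff-recurrence b D i (at e (suc i))) i ℕ.z≤n

  X-*-cancel : ∀ b A B → X- b *ᴾ A ≋ X- b *ᴾ B → A ≋ B
  X-*-cancel b A B e = ≋-trans (≋-sym h1) (≋-trans (+ᴾ-cong (X-*-zero b (A +ᴾ -ᴾ B) h2) (≋-refl {B})) ≋-refl)
    where
    h1 : (A +ᴾ -ᴾ B) +ᴾ B ≋ A
    h1 = ≋-trans (+ᴾ-assoc A (-ᴾ B) B) (≋-trans (+ᴾ-cong (≋-refl {A}) (+ᴾ-invˡ B)) (+ᴾ-idʳ A))
    h2 : X- b *ᴾ (A +ᴾ -ᴾ B) ≋ []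
    h2 = ≋-trans (distribˡᴾ (X- b) A (-ᴾ B)) (≋-trans (+ᴾ-cong e (≋-sym (PR.-‿distribʳ-* (X- b) B))) (+ᴾ-invʳ (X- b *ᴾ B)))

  ≋-subtract : ∀ {x y z} → x ≋ y +ᴾ z → z ≋ x +ᴾ -ᴾ y
  ≋-subtract {x} {y} {z} e = ≋-trans (≋-sym (≋-trans (+ᴾ-cong (≋-refl {z}) (+ᴾ-invʳ y)) (+ᴾ-idʳ z)))
    (≋-trans (≋-sym (+ᴾ-assoc z y (-ᴾ y))) (+ᴾ-cong (≋-trans (+ᴾ-comm z y) (≋-sym e)) (≋-refl { -ᴾ y})))

  *ᴾ-leftSwap : ∀ x y w → x *ᴾ (y *ᴾ w) ≋ y *ᴾ (x *ᴾ w)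
  *ᴾ-leftSwap x y w = ≋-trans (≋-sym (*ᴾ-assoc x y w)) (≋-trans (*ᴾ-congˡ w (*ᴾ-comm x y)) (*ᴾ-assoc y x w))

  -- For a ≠ b, X - a = (X - b) + (b - a) with b - a a unit, so X - a and
  -- X - b are coprime: if (X - b) divides (X - a)·Q then it divides Q.
  diff≉0 : ∀ a b → ¬ (a ≈ b) → ¬ (b + - a ≈ 0#)
  diff≉0 a b a≉b z = a≉b (sym (x∙y⁻¹≈ε⇒x≈y b a z))

  coprime-divides : ∀ a b → ¬ (a ≈ b) → ∀ Q T → X- a *ᴾ Q ≋ X- b *ᴾ T → Σ Poly λ Q1 → Q ≋ X- b *ᴾ Q1
  coprime-divides a b ne Q T e with inverse (b + - a) (diff≉0 a b ne)
  ... | u , vu = const u *ᴾ (T +ᴾ -ᴾ Q) , chain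
    where
    v : Poly
    v = const (b + - a)
    h1 : X- a ≋ X- b +ᴾ v
    h1 = cons-cong (sym (trans (sym (+-assoc _ _ _)) (trans (+-congʳ (-‿inverseˡ b)) (+-identityˡ _)))) ≋-refl
    h2 : const u *ᴾ v ≋ 1ᴾ
    h2 = ≋-trans (const-*ᴾ u v) (cons-cong (trans (*-comm u _) vu) ≋-refl)
    h3 : v *ᴾ Q ≋ X- b *ᴾ (T +ᴾ -ᴾ Q)
    h3 = ≋-trans (≋-subtract {X- a *ᴾ Q} {X- b *ᴾ Q} {v *ᴾ Q} (≋-trans (*ᴾ-congˡ Q h1) (distribʳᴾ (X- b) v Q)))
           (≋-trans (+ᴾ-cong e (PR.-‿distribʳ-* (X- b) Q)) (≋-sym (distribˡᴾ (X- b) T (-ᴾ Q))))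
    chain : Q ≋ X- b *ᴾ (const u *ᴾ (T +ᴾ -ᴾ Q))
    chain = ≋-trans (≋-sym (*ᴾ-idˡ Q)) (≋-trans (*ᴾ-congˡ Q (≋-sym h2)) (≋-trans (*ᴾ-assoc (const u) v Q)
              (≋-trans (*ᴾ-congʳ (const u) h3) (*ᴾ-leftSwap (const u) (X- b) _))))

  coprime-divides-power : ∀ a b → ¬ (a ≈ b) → ∀ k W S → X- a *ᴾ W ≋ X- b ^ᴾ k *ᴾ S → Σ Poly λ S' → W ≋ X- b ^ᴾ k *ᴾ S'
  coprime-divides-power a b ne zero    W S e = W , ≋-sym (*ᴾ-idˡ W)
  coprime-divides-power a b ne (suc k) W S e with coprime-divides a b ne W (X- b ^ᴾ k *ᴾ S) (≋-trans e (*ᴾ-assoc (X- b) (X- b ^ᴾ k) S))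
  ... | W1 , eW with coprime-divides-power a b ne k W1 S (X-*-cancel b (X- a *ᴾ W1) (X- b ^ᴾ k *ᴾ S)
         (≋-trans (*ᴾ-leftSwap (X- b) (X- a) W1) (≋-trans (*ᴾ-congʳ (X- a) (≋-sym eW)) (≋-trans e (*ᴾ-assoc (X- b) (X- b ^ᴾ k) S)))))
  ... | S' , eS = S' , ≋-trans eW (≋-trans (*ᴾ-congʳ (X- b) eS) (≋-sym (*ᴾ-assoc (X- b) (X- b ^ᴾ k) S')))

  coprime-powers : ∀ a b → ¬ (a ≈ b) → ∀ j k Q S → X- a ^ᴾ j *ᴾ Q ≋ X- b ^ᴾ k *ᴾ S → Σ Poly λ S' → Q ≋ X- b ^ᴾ k *ᴾ S'
  coprime-powers a b ne zero    k Q S e = S , ≋-trans (≋-sym (*ᴾ-idˡ Q)) e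
  coprime-powers a b ne (suc j) k Q S e with coprime-divides-power a b ne k (X- a ^ᴾ j *ᴾ Q) S (≋-trans (≋-sym (*ᴾ-assoc (X- a) (X- a ^ᴾ j) Q)) e)
  ... | S1 , e1 = coprime-powers a b ne j k Q S1 e1

  Divides : ℕ → Carrier → Poly → Set (c ⊔ ℓ)
  Divides k t P = Σ Poly λ Q → P ≋ X- t ^ᴾ k *ᴾ Q

  -- Root multiplicities at distinct points are bounded by the degree: peel off
  -- (X - t₀)^k₀, then the remaining powers still divide the cofactor by coprimality.
  multiplicity-bound : ∀ K (ts : Fin K → Carrier) → (∀ i j → ts i ≈ ts j → i ≡ j) → ∀ (ks : Fin K → ℕ) D P →
    Deg≡ P D → (∀ l → Divides (ks l) (ts l) P) → Defs.sumℕ K ks ℕ.≤ D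
  multiplicity-bound zero    ts dist ks D P ex dv = ℕ.z≤n
  multiplicity-bound (suc K) ts dist ks D P ex dv with dv Fin.zero
  ... | Q0 , e0 with Deg≡-X-^* (ts Fin.zero) (ks Fin.zero) Q0 D (Deg≡-cong e0 ex)
  ... | le , ex0 = P.subst (Defs.sumℕ (suc K) ks ℕ.≤_) (NP.m+[n∸m]≡n le)
    (NP.+-monoʳ-≤ (ks Fin.zero) (multiplicity-bound K (λ l → ts (Fin.suc l)) (λ i j e → suc-injective (dist _ _ e))
        (λ l → ks (Fin.suc l)) (D ∸ ks Fin.zero) Q0 ex0 dv'))
    where
    dv' : ∀ l → Divides (ks (Fin.suc l)) (ts (Fin.suc l)) Q0
    dv' l with dv (Fin.suc l)
    ... | Ql , el = coprime-powers (ts Fin.zero) (ts (Fin.suc l)) (λ z → 0≢1+n (dist _ _ z)) (ks Fin.zero) (ks (Fin.suc l)) Q0 Ql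
                      (≋-trans (≋-sym e0) el)

-- Equality in F need not be decidable, so case distinctions such as "is
-- some first coordinate nonzero?" are made in the double-negation monad;
-- every conclusion finally needed is negative or decidable, so this is
-- harmless.  Everything rests on one Gaussian elimination step
-- (eliminate-indep), from which we get that k + 1 vectors in Fᵏ are
-- dependent, and that the span of an independent family has a basis in
-- (reversed) echelon form.
module Echelon {c ℓ} (F : Defs.Field c ℓ) where

  open import Data.Nat as ℕ using (ℕ; zero; suc)
  import Data.Nat.Properties as NP
  open import Data.Product using (_,_; Σ; _×_; proj₁; proj₂)
  open import Data.Fin as Fin using (Fin; zero; suc; toℕ; punchIn; punchOut; opposite)
  import Data.Fin.Properties as FP
  import Data.Fin.Permutation as Perm
  open import Data.Vec.Functional using (_∷_; tail; insertAt)
  open import Data.Vec.Functional.Properties using (insertAt-lookup; insertAt-punchIn)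
  open import Relation.Binary.PropositionalEquality as P using (_≡_)
  open import Relation.Nullary using (¬_; yes; no)
  open import Relation.Nullary.Negation using (¬¬-map; negated-stable)
  open import Relation.Nullary.Decidable using (¬¬-excluded-middle)
  open import Algebra.Bundles using (CommutativeRing)
  open import Function using (_∘_)
  open import Level using (_⊔_)

  open Defs.Field F using (inverse; 1≉0)

  R : CommutativeRing c ℓ
  R = Defs.Field.commutativeRing F
  open CommutativeRing R hiding (zero)
  open import Relation.Binary.Reasoning.Setoid setoid
  open import Algebra.Properties.Ring ring using (-‿distribʳ-*; -‿distribˡ-*)

  module DetF = Determinant R
  open DetF using (sum; sum-cong-≋; sum-0; ∑-distrib-+; sum-remove; sum-neg; *-distribʳ-sum; sum-permute)
  open Defs.LinAlg F using (Vect; _≈ᵥ_; zeroᵥ; sumF; dot; lincomb; Span; LinIndep; signed; det)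

  -- The double-negation monad; unlike the library's ¬¬-Monad its bind may
  -- change the universe level.

  return : ∀ {a} {A : Set a} → A → ¬ ¬ A
  return x ¬x = ¬x x

  _>>=_ : ∀ {a b} {A : Set a} {B : Set b} → ¬ ¬ A → (A → ¬ ¬ B) → ¬ ¬ B
  m >>= f = negated-stable (¬¬-map f m)

  ¬¬-all : ∀ n {a} {P : Fin n → Set a} → (∀ i → ¬ ¬ P i) → ¬ ¬ (∀ i → P i)
  ¬¬-all zero    h k = k (λ ())
  ¬¬-all (suc n) {P = P} h k = h zero (λ p₀ → ¬¬-all n {P = P ∘ suc} (h ∘ suc)
    (λ ps → k (λ { zero → p₀ ; (suc i) → ps i })))

  some-nonzero : ∀ n (x : Fin n → Carrier) → ¬ (∀ i → x i ≈ 0#) → ¬ ¬ (Σ (Fin n) λ i → ¬ (x i ≈ 0#))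
  some-nonzero n x h k = ¬¬-all n (λ i x≉0 → k (i , x≉0)) h

  no-zero-divisors : ∀ {x y} → ¬ (y ≈ 0#) → x * y ≈ 0# → x ≈ 0#
  no-zero-divisors {x} {y} y≉0 xy≈0 with inverse y y≉0
  ... | u , yu = begin
    x           ≈⟨ sym (trans (*-congˡ yu) (*-identityʳ _)) ⟩
    x * (y * u) ≈⟨ sym (*-assoc _ _ _) ⟩
    (x * y) * u ≈⟨ *-congʳ xy≈0 ⟩
    0# * u      ≈⟨ zeroˡ u ⟩
    0#          ∎

  sumF≡sum : ∀ k (f : Fin k → Carrier) → sumF k f ≡ sum f
  sumF≡sum zero    f = P.refl
  sumF≡sum (suc k) f = P.cong (f zero +_) (sumF≡sum k (f ∘ suc))

  dot≈ : ∀ {m} (u v : Vect m) → dot u v ≈ sum (λ i → u i * v i)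
  dot≈ {m} u v = reflexive (sumF≡sum m _)

  lc≈ : ∀ {m k} (cs : Fin k → Carrier) (v : Fin k → Vect m) i → lincomb cs v i ≈ sum (λ j → cs j * v j i)
  lc≈ {k = k} cs v i = reflexive (sumF≡sum k _)

  signed≈ : ∀ k {x y} → x ≈ y → signed k x ≈ DetF.signed k y
  signed≈ zero    e = e
  signed≈ (suc k) e = -‿cong (signed≈ k e)

  det≈ : ∀ n (M : Fin n → Fin n → Carrier) → det n M ≈ DetF.det n M
  det≈ zero    M = refl
  det≈ (suc n) M = trans (reflexive (sumF≡sum (suc n) (λ j → signed (toℕ j) (M zero j * det n (DetF.minor M j))))) (sum-cong-≋ {suc n} (λ j → signed≈ (toℕ j)
    {M zero j * det n (DetF.minor M j)} (*-congˡ (det≈ n (DetF.minor M j)))))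

  lc-zero : ∀ {m n} (cs : Fin n → Carrier) (a : Fin n → Vect m) → (∀ j → cs j ≈ 0#) → lincomb cs a ≈ᵥ zeroᵥ
  lc-zero {n = n} cs a e i = trans (lc≈ cs a i) (sum-0 {n} (λ j → trans (*-congʳ (e j)) (zeroˡ _)))

  lc-insert : ∀ {m n} (cs : Fin n → Carrier) l₀ x (v : Fin (suc n) → Vect m) i →
    lincomb (insertAt cs l₀ x) v i ≈ x * v l₀ i + lincomb cs (v ∘ punchIn l₀) i
  lc-insert {n = n} cs l₀ x v i = begin
    lincomb (insertAt cs l₀ x) v i
      ≈⟨ lc≈ (insertAt cs l₀ x) v i ⟩
    sum (λ j → insertAt cs l₀ x j * v j i)
      ≈⟨ sum-remove {i = l₀} (λ j → insertAt cs l₀ x j * v j i) ⟩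
    insertAt cs l₀ x l₀ * v l₀ i + sum (λ j → insertAt cs l₀ x (punchIn l₀ j) * v (punchIn l₀ j) i)
      ≈⟨ +-cong (*-congʳ (reflexive (insertAt-lookup cs l₀ x)))
                (sum-cong-≋ {n} (λ j → *-congʳ (reflexive (insertAt-punchIn cs l₀ x j)))) ⟩
    x * v l₀ i + sum (λ j → cs j * v (punchIn l₀ j) i)
      ≈⟨ +-congˡ (sym (lc≈ cs (v ∘ punchIn l₀) i)) ⟩
    x * v l₀ i + lincomb cs (v ∘ punchIn l₀) i ∎

  indep-nonzero : ∀ {m n} (v : Fin (suc n) → Vect m) → LinIndep v → ∀ l → ¬ (∀ i → v l i ≈ 0#)
  indep-nonzero v ind l v≈0 =
    1≉0 (trans (sym (reflexive (insertAt-lookup (λ _ → 0#) l 1#))) (ind (insertAt (λ _ → 0#) l 1#) vanishes l))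
    where
    vanishes : lincomb (insertAt (λ _ → 0#) l 1#) v ≈ᵥ zeroᵥ
    vanishes i = trans (lc-insert (λ _ → 0#) l 1# v i)
      (trans (+-cong (trans (*-identityˡ _) (v≈0 i)) (lc-zero (λ _ → 0#) (v ∘ punchIn l) (λ _ → refl) i)) (+-identityʳ _))

  tails-indep : ∀ {m n} (v : Fin n → Vect (suc m)) → (∀ l → v l zero ≈ 0#) → LinIndep v → LinIndep (tail ∘ v)
  tails-indep {n = n} v v₀≈0 ind cs lc≈0 = ind cs vanishes
    where
    vanishes : lincomb cs v ≈ᵥ zeroᵥ
    vanishes zero    = trans (lc≈ cs v zero) (sum-0 {n} (λ l → trans (*-congˡ (v₀≈0 l)) (zeroʳ _)))
    vanishes (suc i) = lc≈0 i

  -- One step of Gaussian elimination: from every vector but the pivot vector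
  -- v l₀, subtract the multiple of v l₀ that clears coordinate i₀ (when u is
  -- the inverse of v l₀ i₀).
  eliminate : ∀ {m n} (v : Fin (suc n) → Vect m) (l₀ : Fin (suc n)) (i₀ : Fin m) (u : Carrier) → Fin n → Vect m
  eliminate v l₀ i₀ u l i = v (punchIn l₀ l) i + - ((v (punchIn l₀ l) i₀ * u) * v l₀ i)

  eliminate-pivot : ∀ {m n} (v : Fin (suc n) → Vect m) l₀ i₀ u → v l₀ i₀ * u ≈ 1# →
                    ∀ l → eliminate v l₀ i₀ u l i₀ ≈ 0#
  eliminate-pivot v l₀ i₀ u vu l = trans
    (+-congˡ (-‿cong (trans (*-assoc _ u _) (trans (*-congˡ (trans (*-comm u _) vu)) (*-identityʳ _)))))
    (-‿inverseʳ _)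

  -- Elimination preserves independence: a dependency among the new vectors
  -- is a dependency among the old ones.
  eliminate-indep : ∀ {m n} (v : Fin (suc n) → Vect m) l₀ i₀ u → LinIndep v → LinIndep (eliminate v l₀ i₀ u)
  eliminate-indep {m} {n} v l₀ i₀ u ind cs lc≈0 l =
    trans (sym (reflexive (insertAt-punchIn cs l₀ x l))) (ind (insertAt cs l₀ x) vanishes (punchIn l₀ l))
    where
    α : Fin n → Carrier
    α l = v (punchIn l₀ l) i₀ * u
    x : Carrier
    x = - sum (λ l → cs l * α l)
    pivot-part : ∀ i → sum (λ l → - (cs l * (α l * v l₀ i))) ≈ x * v l₀ i
    pivot-part i = begin
      sum (λ l → - (cs l * (α l * v l₀ i))) ≈⟨ sym (sum-neg {n} _) ⟩
      - sum (λ l → cs l * (α l * v l₀ i))   ≈⟨ -‿cong (sum-cong-≋ {n} (λ l → sym (*-assoc _ _ _))) ⟩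
      - sum (λ l → (cs l * α l) * v l₀ i)   ≈⟨ -‿cong (sym (*-distribʳ-sum {n} (v l₀ i) _)) ⟩
      - (sum (λ l → cs l * α l) * v l₀ i)   ≈⟨ -‿distribˡ-* _ _ ⟩
      x * v l₀ i                            ∎
    lc-eliminate : ∀ i → lincomb cs (eliminate v l₀ i₀ u) i ≈ x * v l₀ i + lincomb cs (v ∘ punchIn l₀) i
    lc-eliminate i = begin
      lincomb cs (eliminate v l₀ i₀ u) i
        ≈⟨ lc≈ cs (eliminate v l₀ i₀ u) i ⟩
      sum (λ l → cs l * (v (punchIn l₀ l) i + - (α l * v l₀ i)))
        ≈⟨ sum-cong-≋ {n} (λ l → trans (distribˡ _ _ _) (+-congˡ (sym (-‿distribʳ-* _ _)))) ⟩
      sum (λ l → cs l * v (punchIn l₀ l) i + - (cs l * (α l * v l₀ i)))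
        ≈⟨ ∑-distrib-+ {n} _ _ ⟩
      sum (λ l → cs l * v (punchIn l₀ l) i) + sum (λ l → - (cs l * (α l * v l₀ i)))
        ≈⟨ +-comm _ _ ⟩
      sum (λ l → - (cs l * (α l * v l₀ i))) + sum (λ l → cs l * v (punchIn l₀ l) i)
        ≈⟨ +-cong (pivot-part i) (sym (lc≈ cs (v ∘ punchIn l₀) i)) ⟩
      x * v l₀ i + lincomb cs (v ∘ punchIn l₀) i ∎
    vanishes : lincomb (insertAt cs l₀ x) v ≈ᵥ zeroᵥ
    vanishes i = trans (lc-insert cs l₀ x v i) (trans (sym (lc-eliminate i)) (lc≈0 i))

  -- Induction on the number of coordinates along Gaussian elimination: to
  -- establish a property P of all independent families it suffices to treat
  -- the empty family in F⁰, a first coordinate vanishing on the whole family,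
  -- and the family reconstructed from a pivot vector and the eliminated rest.
  module _ {p} (P : ∀ m n → (Fin n → Vect m) → Set p)
    (base : ∀ v → P 0 0 v)
    (zero-column : ∀ {m n} (v : Fin n → Vect (suc m)) → (∀ l → v l zero ≈ 0#) → P m n (tail ∘ v) → P (suc m) n v)
    (pivot-step : ∀ {m n} (v : Fin (suc n) → Vect (suc m)) l₀ u → v l₀ zero * u ≈ 1# →
                  P m n (tail ∘ eliminate v l₀ zero u) → P (suc m) (suc n) v)
    where

    elimination-induction : ∀ m n (v : Fin n → Vect m) → LinIndep v → ¬ ¬ P m n v
    elimination-induction zero    zero    v ind = return (base v)
    elimination-induction zero    (suc n) v ind = λ _ → indep-nonzero v ind zero (λ ())
    elimination-induction (suc m) n       v ind = ¬¬-excluded-middle {A = ∀ l → v l zero ≈ 0#} >>= λ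
      { (yes v₀≈0) → ¬¬-map (zero-column v v₀≈0) (elimination-induction m n (tail ∘ v) (tails-indep v v₀≈0 ind))
      ; (no v₀≉0)  → with-pivot n v ind v₀≉0 }
      where
      with-pivot : ∀ n (v : Fin n → Vect (suc m)) → LinIndep v → ¬ (∀ l → v l zero ≈ 0#) → ¬ ¬ P (suc m) n v
      with-pivot zero    v ind v₀≉0 = λ _ → v₀≉0 (λ ())
      with-pivot (suc n) v ind v₀≉0 = some-nonzero (suc n) (λ l → v l zero) v₀≉0 >>= λ { (l₀ , v₀≉0) → pivot l₀ v₀≉0 }
        where
        pivot : ∀ l₀ → ¬ (v l₀ zero ≈ 0#) → ¬ ¬ P (suc m) (suc n) v
        pivot l₀ v₀≉0 with inverse (v l₀ zero) v₀≉0
        ... | u , vu = ¬¬-map (pivot-step v l₀ u vu) (elimination-induction m n (tail ∘ eliminate v l₀ zero u)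
          (tails-indep (eliminate v l₀ zero u) (eliminate-pivot v l₀ zero u vu) (eliminate-indep v l₀ zero u ind)))

  -- k + 1 vectors in Fᵏ are linearly dependent: elimination never produces
  -- more vectors than coordinates.
  too-many-vectors : ∀ k (v : Fin (suc k) → Vect k) → ¬ LinIndep v
  too-many-vectors k v ind = elimination-induction (λ m n _ → n ℕ.≤ m) (λ _ → ℕ.z≤n) (λ _ _ n≤m → NP.m≤n⇒m≤1+n n≤m)
    (λ _ _ _ _ → ℕ.s≤s) k (suc k) v ind (NP.n≮n k)

  Increasing : ∀ {r m} → (Fin r → Fin m) → Set
  Increasing p = ∀ j j' → toℕ j ℕ.< toℕ j' → toℕ (p j) ℕ.< toℕ (p j')

  Echelon : ∀ {r m} → (Fin r → Vect m) → (Fin r → Fin m) → Set ℓ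
  Echelon φ p = Increasing p × (∀ j → φ j (p j) ≈ 1#) × (∀ j i → toℕ i ℕ.< toℕ (p j) → φ j i ≈ 0#)

  RevEchelon : ∀ {r m} → (Fin r → Vect m) → (Fin r → Fin m) → Set ℓ
  RevEchelon φ p = Increasing p × (∀ j → φ j (p j) ≈ 1#) × (∀ j i → toℕ (p j) ℕ.< toℕ i → φ j i ≈ 0#)

  EchelonSpanning : ∀ m n → (Fin n → Vect m) → Set (c ⊔ ℓ)
  EchelonSpanning m n v = Σ (Fin n → Vect m) λ φ → Σ (Fin n → Fin m) λ p → Echelon φ p × (∀ l → Span φ (v l))

  RevEchelonSpanning : ∀ m n → (Fin n → Vect m) → Set (c ⊔ ℓ)
  RevEchelonSpanning m n v = Σ (Fin n → Vect m) λ φ → Σ (Fin n → Fin m) λ p → RevEchelon φ p × (∀ l → Span φ (v l))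

  echelon-zero-column : ∀ {m n} (v : Fin n → Vect (suc m)) → (∀ l → v l zero ≈ 0#) →
    EchelonSpanning m n (tail ∘ v) → EchelonSpanning (suc m) n v
  echelon-zero-column {n = n} v v₀≈0 (φ , p , (inc , piv , before) , spans) =
    (λ j → 0# ∷ φ j) , suc ∘ p ,
    ((λ j j' lt → ℕ.s≤s (inc j j' lt)) , piv , (λ { j zero lt → refl ; j (suc i) (ℕ.s≤s lt) → before j i lt })) ,
    λ l → proj₁ (spans l) , λ
      { zero    → trans (v₀≈0 l) (sym (trans (lc≈ (proj₁ (spans l)) (λ j → 0# ∷ φ j) zero) (sum-0 {n} (λ j → zeroʳ _))))
      ; (suc i) → proj₂ (spans l) i }

  pivot-family : ∀ {m n} (v : Fin (suc n) → Vect (suc m)) l₀ u → (Fin n → Vect m) → Fin (suc n) → Vect (suc m)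
  pivot-family v l₀ u φ' zero    i = u * v l₀ i
  pivot-family v l₀ u φ' (suc j)   = 0# ∷ φ' j

  -- v l₀ is a multiple of the first vector, and every other vector is its
  -- eliminated form plus a multiple of v l₀.
  pivot-family-spans : ∀ {m n} (v : Fin (suc n) → Vect (suc m)) l₀ u (φ' : Fin n → Vect m) → v l₀ zero * u ≈ 1# →
    (∀ l → Span φ' (tail (eliminate v l₀ zero u l))) → ∀ l → Span (pivot-family v l₀ u φ') (v l)
  pivot-family-spans {m} {n} v l₀ u φ' vu spans l with l Fin.≟ l₀
  ... | yes P.refl = insertAt (λ _ → 0#) zero (v l zero) , λ i → sym (begin
        v l zero * (u * v l i) + lincomb (λ _ → 0#) (φ ∘ suc) i
          ≈⟨ +-cong (trans (sym (*-assoc _ u _)) (trans (*-congʳ vu) (*-identityˡ _))) (lc-zero _ (φ ∘ suc) (λ _ → refl) i) ⟩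
        v l i + 0# ≈⟨ +-identityʳ _ ⟩
        v l i      ∎)
    where φ = pivot-family v l₀ u φ'
  ... | no l≢l₀ = P.subst (Span φ ∘ v) (FP.punchIn-punchOut (l≢l₀ ∘ P.sym)) (spans-other (punchOut (l≢l₀ ∘ P.sym)))
    where
    φ = pivot-family v l₀ u φ'
    unit : ∀ a x → (a * v l₀ zero) * (u * x) ≈ a * x
    unit a x = trans (*-assoc a _ _) (*-congˡ (trans (sym (*-assoc _ u x)) (trans (*-congʳ vu) (*-identityˡ x))))
    spans-other : ∀ l → Span φ (v (punchIn l₀ l))
    spans-other l = insertAt cs zero (α * v l₀ zero) , λ i → sym (begin
      (α * v l₀ zero) * (u * v l₀ i) + lincomb cs (φ ∘ suc) i ≈⟨ +-cong (unit α (v l₀ i)) (shifted i) ⟩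
      α * v l₀ i + eliminate v l₀ zero u l i                  ≈⟨ +-comm _ _ ⟩
      (v (punchIn l₀ l) i + - (α * v l₀ i)) + α * v l₀ i      ≈⟨ trans (+-assoc _ _ _) (+-congˡ (-‿inverseˡ _)) ⟩
      v (punchIn l₀ l) i + 0#                                 ≈⟨ +-identityʳ _ ⟩
      v (punchIn l₀ l) i                                      ∎)
      where
      α : Carrier
      α = v (punchIn l₀ l) zero * u
      cs : Fin n → Carrier
      cs = proj₁ (spans l)
      shifted : ∀ i → lincomb cs (φ ∘ suc) i ≈ eliminate v l₀ zero u l i
      shifted zero    = trans (trans (lc≈ cs (φ ∘ suc) zero) (sum-0 {n} (λ j → zeroʳ _)))
                              (sym (eliminate-pivot v l₀ zero u vu l))
      shifted (suc i) = sym (proj₂ (spans l) i)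

  echelon-pivot : ∀ {m n} (v : Fin (suc n) → Vect (suc m)) l₀ u → v l₀ zero * u ≈ 1# →
    EchelonSpanning m n (tail ∘ eliminate v l₀ zero u) → EchelonSpanning (suc m) (suc n) v
  echelon-pivot {m} {n} v l₀ u vu (φ' , p' , (inc , piv , before) , spans) =
    pivot-family v l₀ u φ' , p , (inc₊ , piv₊ , before₊) , pivot-family-spans v l₀ u φ' vu spans
    where
    p : Fin (suc n) → Fin (suc m)
    p zero    = zero
    p (suc j) = suc (p' j)
    inc₊ : Increasing p
    inc₊ zero    (suc j') lt         = ℕ.s≤s ℕ.z≤n
    inc₊ (suc j) (suc j') (ℕ.s≤s lt) = ℕ.s≤s (inc j j' lt)
    piv₊ : ∀ j → pivot-family v l₀ u φ' j (p j) ≈ 1#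
    piv₊ zero    = trans (*-comm u _) vu
    piv₊ (suc j) = piv j
    before₊ : ∀ j i → toℕ i ℕ.< toℕ (p j) → pivot-family v l₀ u φ' j i ≈ 0#
    before₊ zero    i       ()
    before₊ (suc j) zero    lt         = refl
    before₊ (suc j) (suc i) (ℕ.s≤s lt) = before j i lt

  echelon-basis : ∀ m n (v : Fin n → Vect m) → LinIndep v → ¬ ¬ EchelonSpanning m n v
  echelon-basis = elimination-induction EchelonSpanning
    (λ v → (λ ()) , (λ ()) , ((λ ()) , (λ ()) , (λ ())) , (λ ())) echelon-zero-column echelon-pivot

  -- Reversing the coordinates and the order of the family turns echelon into
  -- reversed echelon form.

  opposite-< : ∀ {n} (i j : Fin n) → toℕ i ℕ.< toℕ j → toℕ (opposite j) ℕ.< toℕ (opposite i)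
  opposite-< i j lt = P.subst₂ ℕ._<_ (P.sym (FP.opposite-prop j)) (P.sym (FP.opposite-prop i))
    (NP.∸-monoʳ-< (ℕ.s≤s lt) (FP.toℕ<n j))

  reverse : ∀ {n m} → (Fin n → Vect m) → Fin n → Vect m
  reverse v l i = v l (opposite i)

  reverse-indep : ∀ {m n} (v : Fin n → Vect m) → LinIndep v → LinIndep (reverse v)
  reverse-indep {n = n} v ind cs lc≈0 = ind cs (λ i → begin
    lincomb cs v i                     ≈⟨ lc≈ cs v i ⟩
    sum (λ l → cs l * v l i)           ≈⟨ sum-cong-≋ {n} (λ l → *-congˡ (reflexive (P.cong (v l) (P.sym (FP.opposite-involutive i))))) ⟩
    sum (λ l → cs l * v l (opposite (opposite i))) ≈⟨ sym (lc≈ cs (reverse v) (opposite i)) ⟩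
    lincomb cs (reverse v) (opposite i) ≈⟨ lc≈0 (opposite i) ⟩
    0#                                 ∎)

  reverse-echelon : ∀ {m n} (v : Fin n → Vect m) → EchelonSpanning m n (reverse v) → RevEchelonSpanning m n v
  reverse-echelon {m} {n} v (φ' , p' , (inc , piv , before) , spans) = φ , p , (inc' , piv' , after) , spans'
    where
    φ : Fin n → Vect m
    φ j i = φ' (opposite j) (opposite i)
    p : Fin n → Fin m
    p j = opposite (p' (opposite j))
    back : ∀ {k} (i : Fin k) → opposite (opposite i) ≡ i
    back = FP.opposite-involutive
    inc' : Increasing p
    inc' j j' lt = opposite-< _ _ (inc (opposite j') (opposite j) (opposite-< j j' lt))
    piv' : ∀ j → φ j (p j) ≈ 1#
    piv' j = trans (reflexive (P.cong (φ' (opposite j)) (back (p' (opposite j))))) (piv (opposite j))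
    after : ∀ j i → toℕ (p j) ℕ.< toℕ i → φ j i ≈ 0#
    after j i lt = before (opposite j) (opposite i)
      (P.subst (λ x → toℕ (opposite i) ℕ.< toℕ x) (back (p' (opposite j))) (opposite-< _ _ lt))
    spans' : ∀ l → Span φ (v l)
    spans' l = cs ∘ opposite , λ i → begin
      v l i                                   ≡⟨ P.cong (v l) (P.sym (back i)) ⟩
      reverse v l (opposite i)                ≈⟨ proj₂ (spans l) (opposite i) ⟩
      lincomb cs φ' (opposite i)              ≈⟨ lc≈ cs φ' (opposite i) ⟩
      sum (λ j → cs j * φ' j (opposite i))    ≈⟨ sum-permute (λ j → cs j * φ' j (opposite i)) Perm.reverse ⟩
      sum (λ j → cs (opposite j) * φ j i)     ≈⟨ sym (lc≈ (cs ∘ opposite) φ i) ⟩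
      lincomb (cs ∘ opposite) φ i             ∎
      where cs : Fin n → Carrier
            cs = proj₁ (spans l)

  rev-echelon-basis : ∀ m n (v : Fin n → Vect m) → LinIndep v → ¬ ¬ RevEchelonSpanning m n v
  rev-echelon-basis m n v ind = ¬¬-map (reverse-echelon v) (echelon-basis m n (reverse v) (reverse-indep v ind))

module Orthogonality {c ℓ} (F : Defs.Field c ℓ) where

  open import Data.Nat as ℕ using (ℕ; zero; suc)
  import Data.Nat.Properties as NP
  open import Data.Product using (_,_; Σ; _×_; proj₁; proj₂)
  open import Data.Fin as Fin using (Fin; zero; suc; toℕ; punchIn; punchOut; _↑ˡ_; _↑ʳ_)
  import Data.Fin.Properties as FP
  open import Data.Vec.Functional using (_∷_; tail)
  open import Relation.Binary.PropositionalEquality as P using (_≡_; _≢_)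
  open import Relation.Nullary using (¬_; yes; no)
  open import Data.Empty using (⊥-elim)
  open import Function using (_∘_)
  open import Level using (_⊔_)
  open import Algebra.Bundles using (CommutativeRing)

  open Echelon F
  open Defs.Field F using (inverse)
  open CommutativeRing R hiding (zero)
  open import Relation.Binary.Reasoning.Setoid setoid
  open import Algebra.Properties.Ring ring using (-‿distribˡ-*)
  open import Algebra.Properties.CommutativeSemigroup *-commutativeSemigroup using (x∙yz≈y∙xz; xy∙z≈zx∙y)
  open DetF using (sum; sum-cong-≋; sum-0; ∑-distrib-+; ∑-comm; *-distribˡ-sum; sum-delta; *-distribʳ-sum)
  open Defs.LinAlg F using (Vect; _≈ᵥ_; zeroᵥ; lincomb; LinIndep; dot)

  dot-comm : ∀ {m} (u v : Vect m) → dot u v ≈ dot v u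
  dot-comm {m} u v = trans (dot≈ u v) (trans (sum-cong-≋ {m} (λ i → *-comm (u i) (v i))) (sym (dot≈ v u)))

  dot-congˡ : ∀ {m} {u u' : Vect m} (v : Vect m) → u ≈ᵥ u' → dot u v ≈ dot u' v
  dot-congˡ {m} v e = trans (dot≈ _ v) (trans (sum-cong-≋ {m} (λ i → *-congʳ (e i))) (sym (dot≈ _ v)))

  dot-congʳ : ∀ {m} (u : Vect m) {v v' : Vect m} → v ≈ᵥ v' → dot u v ≈ dot u v'
  dot-congʳ {m} u e = trans (dot≈ u _) (trans (sum-cong-≋ {m} (λ i → *-congˡ (e i))) (sym (dot≈ u _)))

  dot-∷ : ∀ {m} x (φ : Vect m) (v : Vect (suc m)) → dot (x ∷ φ) v ≈ x * v zero + dot φ (tail v)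
  dot-∷ x φ v = refl

  dot-zeroˡ : ∀ {m} (v : Vect m) → dot zeroᵥ v ≈ 0#
  dot-zeroˡ {m} v = trans (dot≈ zeroᵥ v) (sum-0 {m} (λ i → zeroˡ _))

  dot-+* : ∀ {m} (φ a c : Vect m) b → dot φ (λ i → a i + b * c i) ≈ dot φ a + b * dot φ c
  dot-+* {m} φ a c b = begin
    dot φ (λ i → a i + b * c i)                 ≈⟨ dot≈ φ _ ⟩
    sum (λ i → φ i * (a i + b * c i))           ≈⟨ sum-cong-≋ {m} (λ i → trans (distribˡ _ _ _) (+-congˡ (x∙yz≈y∙xz (φ i) b (c i)))) ⟩
    sum (λ i → φ i * a i + b * (φ i * c i))     ≈⟨ ∑-distrib-+ {m} _ _ ⟩
    sum (λ i → φ i * a i) + sum (λ i → b * (φ i * c i))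
      ≈⟨ +-cong (sym (dot≈ φ a)) (trans (sym (*-distribˡ-sum {m} b _)) (*-congˡ (sym (dot≈ φ c)))) ⟩
    dot φ a + b * dot φ c                       ∎

  dot-lc-r : ∀ {m k} (u : Vect m) (cs : Fin k → Carrier) (v : Fin k → Vect m) →
    dot u (lincomb cs v) ≈ sum (λ q → cs q * dot u (v q))
  dot-lc-r {m} {k} u cs v = begin
    dot u (lincomb cs v)                          ≈⟨ dot≈ u _ ⟩
    sum (λ i → u i * lincomb cs v i)
      ≈⟨ sum-cong-≋ {m} (λ i → trans (*-congˡ (lc≈ cs v i)) (trans (*-distribˡ-sum {k} (u i) _)
                                 (sum-cong-≋ {k} (λ q → x∙yz≈y∙xz (u i) (cs q) (v q i))))) ⟩
    sum (λ i → sum (λ q → cs q * (u i * v q i)))  ≈⟨ ∑-comm (λ i q → cs q * (u i * v q i)) ⟩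
    sum (λ q → sum (λ i → cs q * (u i * v q i)))
      ≈⟨ sum-cong-≋ {k} (λ q → trans (sym (*-distribˡ-sum (cs q) (λ i → u i * v q i))) (*-congˡ (sym (dot≈ u (v q))))) ⟩
    sum (λ q → cs q * dot u (v q))                ∎

  dot-lc-l : ∀ {m k} (cs : Fin k → Carrier) (v : Fin k → Vect m) (u : Vect m) →
    dot (lincomb cs v) u ≈ sum (λ q → cs q * dot (v q) u)
  dot-lc-l {k = k} cs v u = trans (dot-comm (lincomb cs v) u)
    (trans (dot-lc-r u cs v) (sum-cong-≋ {k} (λ q → *-congˡ (dot-comm u (v q)))))

  orthogonalise : ∀ {m} (x : Vect m) (a : Vect (suc m)) u → a zero * u ≈ 1# →
                  dot (- (u * dot x (tail a)) ∷ x) a ≈ 0#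
  orthogonalise x a u au = begin
    dot (- (u * d) ∷ x) a  ≈⟨ dot-∷ (- (u * d)) x a ⟩
    - (u * d) * a zero + d ≈⟨ +-congʳ (trans (sym (-‿distribˡ-* _ _)) (-‿cong (begin
                                (u * d) * a zero ≈⟨ *-assoc u d _ ⟩
                                u * (d * a zero) ≈⟨ x∙yz≈y∙xz u d _ ⟩
                                d * (u * a zero) ≈⟨ *-congˡ (trans (*-comm u _) au) ⟩
                                d * 1#           ≈⟨ *-identityʳ d ⟩
                                d                ∎))) ⟩
    - d + d                ≈⟨ -‿inverseˡ d ⟩
    0#                     ∎
    where d : Carrier
          d = dot x (tail a)

  lc-lc : ∀ {m k n} (λs : Fin k → Carrier) (cs : Fin k → Fin n → Carrier) (a : Fin n → Vect m) i →
    lincomb λs (λ q → lincomb (cs q) a) i ≈ lincomb (λ j → sum (λ q → λs q * cs q j)) a i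
  lc-lc {m} {k} {n} λs cs a i = begin
    lincomb λs (λ q → lincomb (cs q) a) i        ≈⟨ lc≈ λs (λ q → lincomb (cs q) a) i ⟩
    sum (λ q → λs q * lincomb (cs q) a i)
      ≈⟨ sum-cong-≋ {k} (λ q → trans (*-congˡ (lc≈ (cs q) a i)) (trans (*-distribˡ-sum (λs q) (λ j → cs q j * a j i))
                                 (sum-cong-≋ {n} (λ j → sym (*-assoc (λs q) (cs q j) (a j i)))))) ⟩
    sum (λ q → sum (λ j → (λs q * cs q j) * a j i)) ≈⟨ ∑-comm (λ q j → (λs q * cs q j) * a j i) ⟩
    sum (λ j → sum (λ q → (λs q * cs q j) * a j i))
      ≈⟨ sum-cong-≋ {n} (λ j → sym (*-distribʳ-sum (a j i) (λ q → λs q * cs q j))) ⟩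
    sum (λ j → sum (λ q → λs q * cs q j) * a j i) ≈⟨ sym (lc≈ (λ j → sum (λ q → λs q * cs q j)) a i) ⟩
    lincomb (λ j → sum (λ q → λs q * cs q j)) a i ∎

  lc-congᵥ : ∀ {m k} (λs : Fin k → Carrier) {y y' : Fin k → Vect m} → (∀ q → y q ≈ᵥ y' q) → lincomb λs y ≈ᵥ lincomb λs y'
  lc-congᵥ {k = k} λs {y} {y'} e i = trans (lc≈ λs y i) (trans (sum-cong-≋ {k} (λ q → *-congˡ (e q i))) (sym (lc≈ λs y' i)))

  indep-coeffs : ∀ {m k n} (y : Fin k → Vect m) (cs : Fin k → Fin n → Carrier) (a : Fin n → Vect m) →
    (∀ q → y q ≈ᵥ lincomb (cs q) a) → LinIndep y → LinIndep cs
  indep-coeffs y cs a e ind λs z = ind λs (λ i → trans (lc-congᵥ λs e i) (trans (lc-lc λs cs a i)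
    (lc-zero _ a (λ j → trans (sym (lc≈ λs cs j)) (z j)) i)))

  std : ∀ {m} → Fin m → Vect m
  std j i with i Fin.≟ j
  ... | yes _ = 1#
  ... | no _  = 0#

  std-same : ∀ {m} (j : Fin m) → std j j ≈ 1#
  std-same j with j Fin.≟ j
  ... | yes _   = refl
  ... | no j≢j  = ⊥-elim (j≢j P.refl)

  std-other : ∀ {m} (j i : Fin m) → i ≢ j → std j i ≈ 0#
  std-other j i i≢j with i Fin.≟ j
  ... | yes i≡j = ⊥-elim (i≢j i≡j)
  ... | no _    = refl

  std-indep : ∀ {m} → LinIndep (std {m})
  std-indep {m} cs lc≈0 j = trans (sym (begin
    lincomb cs std j        ≈⟨ lc≈ cs std j ⟩
    sum (λ q → cs q * std q j) ≈⟨ sum-delta j _ (λ q q≢j → trans (*-congˡ (std-other q j (q≢j ∘ P.sym))) (zeroʳ _)) ⟩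
    cs j * std j j          ≈⟨ trans (*-congˡ (std-same j)) (*-identityʳ _) ⟩
    cs j                    ∎)) (lc≈0 j)

  RevEchelonComplement : ∀ m n → (Fin n → Vect m) → Set (c ⊔ ℓ)
  RevEchelonComplement m n w = Σ ℕ λ r → (r ℕ.+ n ≡ m) × Σ (Fin r → Vect m) λ φ → Σ (Fin r → Fin m) λ p →
    RevEchelon φ p × (∀ j l → dot (φ j) (w l) ≈ 0#)

  complement-zero-column : ∀ {m n} (w : Fin n → Vect (suc m)) → (∀ l → w l zero ≈ 0#) →
    RevEchelonComplement m n (tail ∘ w) → RevEchelonComplement (suc m) n w
  complement-zero-column w w₀≈0 (r , r+n≡m , φ' , p' , (inc , piv , after) , orth) =
    suc r , P.cong suc r+n≡m , φ , p , (inc₊ , piv₊ , after₊) , orth₊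
    where
    φ : Fin (suc r) → Vect _
    φ zero    = 1# ∷ zeroᵥ
    φ (suc j) = 0# ∷ φ' j
    p : Fin (suc r) → Fin _
    p zero    = zero
    p (suc j) = suc (p' j)
    inc₊ : Increasing p
    inc₊ zero    (suc j') lt         = ℕ.s≤s ℕ.z≤n
    inc₊ (suc j) (suc j') (ℕ.s≤s lt) = ℕ.s≤s (inc j j' lt)
    piv₊ : ∀ j → φ j (p j) ≈ 1#
    piv₊ zero    = refl
    piv₊ (suc j) = piv j
    after₊ : ∀ j i → toℕ (p j) ℕ.< toℕ i → φ j i ≈ 0#
    after₊ zero    (suc i) lt         = refl
    after₊ (suc j) (suc i) (ℕ.s≤s lt) = after j i lt
    orth₊ : ∀ j l → dot (φ j) (w l) ≈ 0#
    orth₊ zero    l = trans (+-cong (trans (*-identityˡ _) (w₀≈0 l)) (dot-zeroˡ (tail (w l)))) (+-identityʳ _)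
    orth₊ (suc j) l = trans (+-cong (zeroˡ _) (orth j l)) (+-identityʳ _)

  complement-pivot : ∀ {m n} (w : Fin (suc n) → Vect (suc m)) l₀ u → w l₀ zero * u ≈ 1# →
    RevEchelonComplement m n (tail ∘ eliminate w l₀ zero u) → RevEchelonComplement (suc m) (suc n) w
  complement-pivot {m} {n} w l₀ u wu (r , r+n≡m , φ' , p' , (inc , piv , after) , orth) =
    r , P.trans (NP.+-suc r n) (P.cong suc r+n≡m) , φ , suc ∘ p' , ((λ j j' lt → ℕ.s≤s (inc j j' lt)) , piv , after₊) , orth₊
    where
    φ : Fin r → Vect (suc m)
    φ j = - (u * dot (φ' j) (tail (w l₀))) ∷ φ' j
    after₊ : ∀ j i → toℕ (suc (p' j)) ℕ.< toℕ i → φ j i ≈ 0#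
    after₊ j (suc i) (ℕ.s≤s lt) = after j i lt
    -- a vector other than the pivot is its eliminated form plus α times w l₀
    orth-other : ∀ j l → dot (φ j) (w (punchIn l₀ l)) ≈ 0#
    orth-other j l = begin
      dot (φ j) (w (punchIn l₀ l))
        ≈⟨ +-congˡ (dot-congʳ (φ' j) (λ i → sym (trans (+-assoc _ _ _) (trans (+-congˡ (-‿inverseˡ _)) (+-identityʳ _))))) ⟩
      - (u * d j) * w (punchIn l₀ l) zero + dot (φ' j) (λ i → eliminate w l₀ zero u l (suc i) + α * tail (w l₀) i)
        ≈⟨ +-congˡ (trans (dot-+* (φ' j) _ (tail (w l₀)) α) (trans (+-congʳ (orth j l)) (+-identityˡ _))) ⟩
      - (u * d j) * w (punchIn l₀ l) zero + α * d j
        ≈⟨ +-congʳ (sym (-‿distribˡ-* _ _)) ⟩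
      - ((u * d j) * w (punchIn l₀ l) zero) + α * d j
        ≈⟨ +-congʳ (-‿cong (xy∙z≈zx∙y u (d j) _)) ⟩
      - ((w (punchIn l₀ l) zero * u) * d j) + α * d j
        ≈⟨ -‿inverseˡ _ ⟩
      0# ∎
      where
      α : Carrier
      α = w (punchIn l₀ l) zero * u
      d : Fin r → Carrier
      d j = dot (φ' j) (tail (w l₀))
    orth₊ : ∀ j l → dot (φ j) (w l) ≈ 0#
    orth₊ j l with l Fin.≟ l₀
    ... | yes P.refl = orthogonalise (φ' j) (w l) u wu
    ... | no l≢l₀    = P.subst (λ l → dot (φ j) (w l) ≈ 0#) (FP.punchIn-punchOut (l≢l₀ ∘ P.sym))
                               (orth-other j (punchOut (l≢l₀ ∘ P.sym)))

  rev-echelon-complement : ∀ m n (w : Fin n → Vect m) → LinIndep w → ¬ ¬ RevEchelonComplement m n w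
  rev-echelon-complement = elimination-induction RevEchelonComplement
    (λ w → 0 , P.refl , (λ ()) , (λ ()) , ((λ ()) , (λ ()) , (λ ())) , (λ ()))
    complement-zero-column complement-pivot

  Triangular : ∀ k m' → (Fin k → Vect (k ℕ.+ m')) → Set ℓ
  Triangular k m' a = (∀ n x → toℕ x ℕ.< toℕ n → a n x ≈ 0#) × (∀ n → ¬ (a n (n ↑ˡ m') ≈ 0#))

  triangular-tail : ∀ k m' (a : Fin (suc k) → Vect (suc k ℕ.+ m')) → Triangular (suc k) m' a →
                    Triangular k m' (tail ∘ a ∘ suc)
  triangular-tail k m' a (below , diag) = (λ n x lt → below (suc n) (suc x) (ℕ.s≤s lt)) , diag ∘ suc

  -- Triangular families are independent: the coefficients vanish one by one.
  triangular-indep : ∀ k m' (a : Fin k → Vect (k ℕ.+ m')) → Triangular k m' a → LinIndep a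
  triangular-indep (suc k) m' a tr cs lc≈0 = c≈0
    where
    -- coordinate 0 of Σ cₙ aₙ is c₀ a₀₀, and the higher ones are those of the tail family
    rest≈0 : lincomb (cs ∘ suc) (a ∘ suc) zero ≈ 0#
    rest≈0 = trans (lc≈ (cs ∘ suc) (a ∘ suc) zero)
      (sum-0 {k} (λ n → trans (*-congˡ (proj₁ tr (suc n) zero (ℕ.s≤s ℕ.z≤n))) (zeroʳ _)))
    c₀≈0 : cs zero ≈ 0#
    c₀≈0 = no-zero-divisors (proj₂ tr zero) (trans (sym (+-identityʳ _)) (trans (+-congˡ (sym rest≈0)) (lc≈0 zero)))
    c≈0 : ∀ n → cs n ≈ 0#
    c≈0 zero    = c₀≈0
    c≈0 (suc n) = triangular-indep k m' (tail ∘ a ∘ suc) (triangular-tail k m' a tr) (cs ∘ suc)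
      (λ i → trans (sym (+-identityˡ _)) (trans (+-congʳ (sym (trans (*-congʳ c₀≈0) (zeroˡ _)))) (lc≈0 (suc i)))) n

  -- m' independent vectors orthogonal to a triangular family: extend the
  -- standard basis of F^m' upwards, orthogonalising against one a n at a time.
  triangular-complement : ∀ k m' (a : Fin k → Vect (k ℕ.+ m')) → Triangular k m' a →
    Σ (Fin m' → Vect (k ℕ.+ m')) λ x → (∀ j n → dot (x j) (a n) ≈ 0#) × LinIndep x
  triangular-complement zero    m' a tr = std , (λ j ()) , std-indep
  triangular-complement (suc k) m' a tr
    with inverse (a zero zero) (proj₂ tr zero) | triangular-complement k m' (tail ∘ a ∘ suc) (triangular-tail k m' a tr)
  ... | u , au | x' , orth' , ind' = x , orth , ind
    where
    x : Fin m' → Vect (suc k ℕ.+ m')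
    x j = - (u * dot (x' j) (tail (a zero))) ∷ x' j
    orth : ∀ j n → dot (x j) (a n) ≈ 0#
    orth j zero    = orthogonalise (x' j) (a zero) u au
    orth j (suc n) = trans (+-cong (trans (*-congˡ (proj₁ tr (suc n) zero (ℕ.s≤s ℕ.z≤n))) (zeroʳ _)) (orth' j n))
                           (+-identityʳ _)
    ind : LinIndep x
    ind cs z = ind' cs (z ∘ suc)

  -- A vector orthogonal to a triangular family and vanishing on the last m'
  -- coordinates is zero: solve for the coordinates from the bottom up.
  triangular-complement-zero : ∀ k m' (a : Fin k → Vect (k ℕ.+ m')) → Triangular k m' a → ∀ (y : Vect (k ℕ.+ m')) →
    (∀ n → dot y (a n) ≈ 0#) → (∀ j → y (k ↑ʳ j) ≈ 0#) → ∀ i → y i ≈ 0#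
  triangular-complement-zero zero    m' a tr y orth y-tail≈0 i = y-tail≈0 i
  triangular-complement-zero (suc k) m' a tr y orth y-tail≈0 = y≈0
    where
    split : ∀ n → dot y (a n) ≈ y zero * a n zero + dot (tail y) (tail (a n))
    split n = sym (dot-congˡ {u = y zero ∷ tail y} {u' = y} (a n) (λ { zero → refl ; (suc i) → refl }))
    tail≈0 : ∀ i → tail y i ≈ 0#
    tail≈0 = triangular-complement-zero k m' (tail ∘ a ∘ suc) (triangular-tail k m' a tr) (tail y)
      (λ n → trans (sym (trans (+-congʳ (trans (*-congˡ (proj₁ tr (suc n) zero (ℕ.s≤s ℕ.z≤n))) (zeroʳ _))) (+-identityˡ _)))
                   (trans (sym (split (suc n))) (orth (suc n))))
      y-tail≈0
    y₀a₀≈0 : y zero * a zero zero ≈ 0#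
    y₀a₀≈0 = begin
      y zero * a zero zero                                    ≈⟨ sym (+-identityʳ _) ⟩
      y zero * a zero zero + 0#                               ≈⟨ +-congˡ (sym (trans (dot≈ (tail y) (tail (a zero)))
                                                                   (sum-0 (λ i → trans (*-congʳ (tail≈0 i)) (zeroˡ _))))) ⟩
      y zero * a zero zero + dot (tail y) (tail (a zero))     ≈⟨ sym (split zero) ⟩
      dot y (a zero)                                          ≈⟨ orth zero ⟩
      0#                                                      ∎
    y≈0 : ∀ i → y i ≈ 0#
    y≈0 zero    = no-zero-divisors (proj₂ tr zero) y₀a₀≈0
    y≈0 (suc i) = tail≈0 i

-- One kernel vector c is used to replace a
-- row i₀ (with c i₀ ≠ 0) by Σᵢ cᵢ·(row i), which vanishes at t and so is
-- divisible by X - t; the remaining kernel vectors, with coordinate i₀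
-- eliminated, stay independent and in the kernel of the new matrix.
module KernelMultiplicity {c ℓ} (F : Defs.Field c ℓ) where

  open import Data.Nat using (zero; suc)
  open import Data.Product using (_,_)
  open import Data.Fin as Fin using (Fin; zero; suc)
  import Relation.Binary.PropositionalEquality as P
  open import Relation.Nullary using (¬_; yes; no)
  open import Relation.Nullary.Negation using (¬¬-map)
  open import Algebra.Bundles using (CommutativeRing)

  open RootMultiplicity F
  open Echelon F hiding (R; module DetF)
  open Defs.Field F using (inverse)
  open Defs.LinAlg F using (Vect; LinIndep)
  open CommutativeRing R hiding (zero)
  open import Relation.Binary.Reasoning.Setoid setoid
  open import Algebra.Properties.Ring ring using (-‿distribˡ-*; -0#≈0#)
  open DetF using (sum; sum-cong-≋; ∑-distrib-+; *-distribˡ-sum; sum-neg)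

  LeftKernel : ∀ {n} → (Fin n → Fin n → Poly) → Carrier → (Fin n → Carrier) → Set ℓ
  LeftKernel {n} M t c = ∀ j → sum (λ i → c i * eval (M i j) t) ≈ 0#

  kernel-row : ∀ {n} (M : Fin n → Fin n → Poly) t (c : Fin n → Carrier) → Fin n → Poly
  kernel-row M t c j = quot t (DetP.sum (λ i → const (c i) *ᴾ M i j))

  kernel-factor : ∀ {n} (M : Fin n → Fin n → Poly) t c i₀ → LeftKernel M t c →
    const (c i₀) *ᴾ DetP.det n M ≋ X- t *ᴾ DetP.det n (M DetP.[ i₀ ]≔ kernel-row M t c)
  kernel-factor {n} M t c i₀ ker = ≋-trans (≋-sym (DetP.det-row-combination n M i₀ (λ i → const (c i))))
    (≋-trans (DetP.det-cong n (DetP.replace-cong M i₀ (λ j → root-factor t (row j) (root j))))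
             (DetP.det-row-* n M i₀ (X- t) (kernel-row M t c)))
    where
    row : Fin n → Poly
    row j = DetP.sum (λ i → const (c i) *ᴾ M i j)
    root : ∀ j → eval (row j) t ≈ 0#
    root j = trans (eval-sum n _ t) (trans (sum-cong-≋ {n} (λ i → eval-const-*ᴾ (c i) (M i j) t)) (ker j))

  kernel-change-row : ∀ {n} (M : Fin n → Fin n → Poly) t i₀ r (d : Fin n → Carrier) → d i₀ ≈ 0# →
    LeftKernel M t d → LeftKernel (M DetP.[ i₀ ]≔ r) t d
  kernel-change-row {n} M t i₀ r d d≈0 ker j = trans (sum-cong-≋ {n} term) (ker j)
    where
    term : ∀ i → d i * eval ((M DetP.[ i₀ ]≔ r) i j) t ≈ d i * eval (M i j) t
    term i with i Fin.≟ i₀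
    ... | yes P.refl = trans (*-congʳ d≈0) (trans (zeroˡ _) (sym (trans (*-congʳ d≈0) (zeroˡ _))))
    ... | no i≢i₀    = *-congˡ (eval-cong t (DetP.other-row M i₀ r i j i≢i₀))

  kernel-eliminate : ∀ {n k} (M : Fin n → Fin n → Poly) t (cs : Fin (suc k) → Vect n) i₀ u →
    (∀ q → LeftKernel M t (cs q)) → ∀ q → LeftKernel M t (eliminate cs zero i₀ u q)
  kernel-eliminate {n} M t cs i₀ u ker q j = begin
    sum (λ i → (a i + - (β * b i)) * e i)
      ≈⟨ sum-cong-≋ {n} (λ i → trans (distribʳ _ _ _) (+-congˡ (trans (sym (-‿distribˡ-* _ _)) (-‿cong (*-assoc β (b i) (e i)))))) ⟩
    sum (λ i → a i * e i + - (β * (b i * e i)))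
      ≈⟨ ∑-distrib-+ {n} _ _ ⟩
    sum (λ i → a i * e i) + sum (λ i → - (β * (b i * e i)))
      ≈⟨ +-congˡ (trans (sym (sum-neg {n} _)) (-‿cong (sym (*-distribˡ-sum {n} β _)))) ⟩
    sum (λ i → a i * e i) + - (β * sum (λ i → b i * e i))
      ≈⟨ +-cong (ker (suc q) j) (trans (-‿cong (trans (*-congˡ (ker zero j)) (zeroʳ _))) -0#≈0#) ⟩
    0# + 0#
      ≈⟨ +-identityʳ _ ⟩
    0# ∎
    where
    a b e : Fin n → Carrier
    a = cs (suc q)
    b = cs zero
    e i = eval (M i j) t
    β : Carrier
    β = cs (suc q) i₀ * u

  divides-step : ∀ k t a u D D' → a * u ≈ 1# → const a *ᴾ D ≋ X- t *ᴾ D' →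
                 Divides k t D' → Divides (suc k) t D
  divides-step k t a u D D' au aD≋XD' (Q , D'≋) = const u *ᴾ Q ,
    ≋-trans (≋-sym (*ᴾ-idˡ D))
    (≋-trans (*ᴾ-congˡ D (≋-sym (const-inv a u au)))
    (≋-trans (*ᴾ-assoc (const u) (const a) D)
    (≋-trans (*ᴾ-congʳ (const u) (≋-trans aD≋XD' (*ᴾ-congʳ X D'≋)))
    (≋-trans (*ᴾ-leftSwap (const u) X _)
    (≋-trans (*ᴾ-congʳ X (*ᴾ-leftSwap (const u) (X ^ᴾ k) Q))
             (≋-sym (*ᴾ-assoc X (X ^ᴾ k) (const u *ᴾ Q))))))))
    where X : Poly
          X = X- t

  kernel-multiplicity : ∀ k n (M : Fin n → Fin n → Poly) t (cs : Fin k → Vect n) → LinIndep cs →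
    (∀ q → LeftKernel M t (cs q)) → ¬ ¬ Divides k t (DetP.det n M)
  kernel-multiplicity zero    n M t cs ind ker = return (DetP.det n M , ≋-sym (*ᴾ-idˡ _))
  kernel-multiplicity (suc k) n M t cs ind ker =
    some-nonzero n (cs zero) (indep-nonzero cs ind zero) >>= λ { (i₀ , c≉0) → pivot i₀ c≉0 }
    where
    pivot : ∀ i₀ → ¬ (cs zero i₀ ≈ 0#) → ¬ ¬ Divides (suc k) t (DetP.det n M)
    pivot i₀ c≉0 with inverse (cs zero i₀) c≉0
    ... | u , cu = ¬¬-map (divides-step k t (cs zero i₀) u _ _ cu (kernel-factor M t (cs zero) i₀ (ker zero)))
      (kernel-multiplicity k n (M DetP.[ i₀ ]≔ kernel-row M t (cs zero)) t (eliminate cs zero i₀ u)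
        (eliminate-indep cs zero i₀ u ind)
        (λ q → kernel-change-row M t i₀ _ _ (eliminate-pivot cs zero i₀ u cu q) (kernel-eliminate M t cs i₀ u ker q)))

-- For
-- r vectors φ j in reversed echelon form with pivots p, consider the r × r
-- polynomial matrix of pairings N φ with N φ i j (t) = ⟨φ j, a^[i](t)⟩.
-- Its determinant has exact degree Σ p j - Σ j ≤ r·s: multiplying row i by
-- X^i gives entries Σₓ φ j x h(x,i) Xˣ of degree ≤ p j whose top
-- coefficients h(p j, i) form a nonzero maximal minor.
module PairingMatrix {c ℓ} (F : Defs.Field c ℓ) (r s : Data.Nat.ℕ)
  (h : Data.Fin.Fin (r Data.Nat.+ s) → Data.Fin.Fin r → Defs.Field.Carrier F)
  (h-lower : ∀ i n → Data.Nat._<_ (Data.Fin.toℕ i) (Data.Fin.toℕ n) → Defs.Field._≈_ F (h i n) (Defs.Field.0# F))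
  (h-minors : ∀ (ι : Data.Fin.Fin r → Data.Fin.Fin (r Data.Nat.+ s)) →
              (∀ p q → Data.Fin._<_ p q → Data.Fin._<_ (ι p) (ι q)) →
              Relation.Nullary.¬_ (Defs.Field._≈_ F (Defs.LinAlg.det F r (λ n q → h (ι q) n)) (Defs.Field.0# F)))
  where

  open import Data.Nat as ℕ using (ℕ; zero; suc; _∸_)
  import Data.Nat.Properties as NP
  open import Data.Fin as Fin using (Fin; zero; suc; toℕ)
  import Data.Fin.Properties as FP
  open import Data.Product using (_,_; _×_; proj₁; proj₂)
  open import Relation.Binary.PropositionalEquality as P using (_≡_)
  open import Relation.Nullary using (¬_; yes; no)
  open import Function using (_∘_)
  open import Relation.Nullary.Negation using (¬¬-map)
  open import Relation.Nullary.Decidable using (decidable-stable)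
  open import Algebra.Bundles using (CommutativeRing)

  open RootMultiplicity F
  open Echelon F hiding (R; module DetF)
  open KernelMultiplicity F
  open CommutativeRing R hiding (zero)
  open import Relation.Binary.Reasoning.Setoid setoid
  open DetF using (sum; sum-cong-≋; sum-delta)
  open Defs.LinAlg F using (aVec; Vect; dot; pow)
  open import Algebra.Properties.CommutativeSemigroup NP.+-commutativeSemigroup using () renaming (interchange to ℕ-interchange)

  m : ℕ
  m = r ℕ.+ s

  pow≡power : ∀ t k → pow t k ≡ power t k
  pow≡power t zero    = P.refl
  pow≡power t (suc k) = P.cong (t *_) (pow≡power t k)

  N : (Fin r → Vect m) → Fin r → Fin r → Poly
  N φ i j = DetP.sum (λ x → const (φ j x * h x i) *ᴾ mono (toℕ x ∸ toℕ i) 1#)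

  N⁺ : (Fin r → Vect m) → Fin r → Fin r → Poly
  N⁺ φ i j = DetP.sum (λ x → mono (toℕ x) (φ j x * h x i))

  eval-N : ∀ φ i j t → eval (N φ i j) t ≈ dot (φ j) (aVec h i t)
  eval-N φ i j t = begin
    eval (N φ i j) t                                                ≈⟨ eval-sum m _ t ⟩
    sum (λ x → eval (const (φ j x * h x i) *ᴾ mono (toℕ x ∸ toℕ i) 1#) t) ≈⟨ sum-cong-≋ {m} term ⟩
    sum (λ x → φ j x * (h x i * pow t (toℕ x ∸ toℕ i)))             ≈⟨ sym (dot≈ (φ j) (aVec h i t)) ⟩
    dot (φ j) (aVec h i t)                                          ∎
    where
    term : ∀ x → eval (const (φ j x * h x i) *ᴾ mono (toℕ x ∸ toℕ i) 1#) t ≈ φ j x * (h x i * pow t (toℕ x ∸ toℕ i))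
    term x = trans (eval-const-*ᴾ (φ j x * h x i) (mono (toℕ x ∸ toℕ i) 1#) t)
      (trans (*-congˡ (trans (eval-mono (toℕ x ∸ toℕ i) 1# t) (*-identityˡ _)))
      (trans (*-assoc (φ j x) (h x i) _) (*-congˡ (*-congˡ (reflexive (P.sym (pow≡power t (toℕ x ∸ toℕ i))))))))

  -- X^i · X^(x-i) = X^x when i ≤ x; otherwise h(x, i) = 0.
  shift-N : ∀ φ i j → mono (toℕ i) 1# *ᴾ N φ i j ≋ N⁺ φ i j
  shift-N φ i j = ≋-trans (DetP.*-distribˡ-sum {m} (mono (toℕ i) 1#) _) (DetP.sum-cong-≋ {m} term)
    where
    term : ∀ x → mono (toℕ i) 1# *ᴾ (const (φ j x * h x i) *ᴾ mono (toℕ x ∸ toℕ i) 1#) ≋ mono (toℕ x) (φ j x * h x i)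
    term x with toℕ i ℕ.≤? toℕ x
    ... | yes i≤x = ≋-trans (*ᴾ-congʳ (mono (toℕ i) 1#) (≋-trans (const-*ᴾ _ _) (scale-mono _ _ 1#)))
      (≋-trans (mono-mul (toℕ i) 1# (toℕ x ∸ toℕ i) _)
      (P.subst (λ e → mono (toℕ i ℕ.+ (toℕ x ∸ toℕ i)) (1# * (φ j x * h x i * 1#)) ≋ mono e (φ j x * h x i))
               (NP.m+[n∸m]≡n i≤x) (mono-cong _ (trans (*-identityˡ _) (*-identityʳ _)))))
    ... | no i≰x = ≋-trans (*ᴾ-congʳ (mono (toℕ i) 1#) (≋-trans (const-*ᴾ _ _) (≋-trans (scale-cong φh≈0 ≋-refl) (scale-0 _))))
      (≋-trans (*ᴾ-[] (mono (toℕ i) 1#)) (≋-sym (mono-zero (toℕ x) φh≈0)))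
      where φh≈0 : φ j x * h x i ≈ 0#
            φh≈0 = trans (*-congˡ (h-lower x i (NP.≰⇒> i≰x))) (zeroʳ _)

  prod-monomials : ∀ n (g : Fin n → ℕ) → DetP.prod n (λ i → mono (g i) 1#) ≋ mono (Defs.sumℕ n g) 1#
  prod-monomials zero    g = ≋-refl
  prod-monomials (suc n) g = ≋-trans (*ᴾ-congʳ (mono (g zero) 1#) (prod-monomials n (g ∘ suc)))
                                     (≋-trans (mono-mul (g zero) 1# _ 1#) (mono-cong _ (*-identityˡ 1#)))

  -- Pivots of an increasing family of r positions in Fin (r + s) satisfy
  -- p j ≤ s + j: after p j there is room for the r - 1 - j later pivots.

  increasing-room : ∀ n M (p : Fin n → Fin M) → Increasing p → ∀ j → toℕ (p j) ℕ.+ (n ∸ suc (toℕ j)) ℕ.< M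
  increasing-room (suc n)       M p inc (suc j) = increasing-room n M (p ∘ suc) (λ j j' lt → inc (suc j) (suc j') (ℕ.s≤s lt)) j
  increasing-room (suc zero)    M p inc zero = P.subst (ℕ._< M) (P.sym (NP.+-identityʳ _)) (FP.toℕ<n (p zero))
  increasing-room (suc (suc n)) M p inc zero = NP.≤-<-trans
    (P.subst (ℕ._≤ toℕ (p (suc zero)) ℕ.+ n) (P.sym (NP.+-suc (toℕ (p zero)) n)) (NP.+-monoˡ-≤ n (inc zero (suc zero) (ℕ.s≤s ℕ.z≤n))))
    (increasing-room (suc n) M (p ∘ suc) (λ j j' lt → inc (suc j) (suc j') (ℕ.s≤s lt)) zero)

  pivot-bound : ∀ (p : Fin r → Fin m) → Increasing p → ∀ j → toℕ (p j) ℕ.≤ s ℕ.+ toℕ j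
  pivot-bound p inc j = P.subst (toℕ (p j) ℕ.≤_) (NP.+-comm (toℕ j) s) (ℕ.s≤s⁻¹ (NP.+-cancelˡ-< d _ _ room))
    where
    d : ℕ
    d = r ∸ suc (toℕ j)
    room : d ℕ.+ toℕ (p j) ℕ.< d ℕ.+ suc (toℕ j ℕ.+ s)
    room = P.subst₂ ℕ._<_ (NP.+-comm (toℕ (p j)) d)
      (P.trans (P.cong (ℕ._+ s) (P.sym (NP.m∸n+n≡m (FP.toℕ<n j)))) (NP.+-assoc d (suc (toℕ j)) s))
      (increasing-room r m p inc j)

  sumℕ-mono : ∀ n (f g : Fin n → ℕ) → (∀ j → f j ℕ.≤ g j) → Defs.sumℕ n f ℕ.≤ Defs.sumℕ n g
  sumℕ-mono zero    f g f≤g = ℕ.z≤n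
  sumℕ-mono (suc n) f g f≤g = NP.+-mono-≤ (f≤g zero) (sumℕ-mono n _ _ (f≤g ∘ suc))

  sumℕ-+ : ∀ n a (f : Fin n → ℕ) → Defs.sumℕ n (λ j → a ℕ.+ f j) ≡ n ℕ.* a ℕ.+ Defs.sumℕ n f
  sumℕ-+ zero    a f = P.refl
  sumℕ-+ (suc n) a f = P.trans (P.cong ((a ℕ.+ f zero) ℕ.+_) (sumℕ-+ n a (f ∘ suc))) (ℕ-interchange a (f zero) (n ℕ.* a) _)

  module EchelonPairing (φ : Fin r → Vect m) (p : Fin r → Fin m) (ech : RevEchelon φ p) where

    S E : ℕ
    S = Defs.sumℕ r (toℕ ∘ p)
    E = Defs.sumℕ r toℕ

    degree-N⁺ : ∀ i j → Deg≤ (N⁺ φ i j) (toℕ (p j))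
    degree-N⁺ i j = Deg≤-sum m _ (toℕ (p j)) term
      where
      term : ∀ x → Deg≤ (mono (toℕ x) (φ j x * h x i)) (toℕ (p j))
      term x with toℕ x ℕ.≤? toℕ (p j)
      ... | yes x≤p = Deg≤-mono (toℕ x) _ _ x≤p
      ... | no x≰p  = Deg≤-cong (≋-sym (mono-zero (toℕ x) (trans (*-congʳ (proj₂ (proj₂ ech) j x (NP.≰⇒> x≰p))) (zeroˡ _))))
                                (Deg≤-[] _)

    top-N⁺ : ∀ i j → coeff (N⁺ φ i j) (toℕ (p j)) ≈ h (p j) i
    top-N⁺ i j = begin
      coeff (N⁺ φ i j) (toℕ (p j))                         ≈⟨ coeff-sum m _ (toℕ (p j)) ⟩
      sum (λ x → coeff (mono (toℕ x) (φ j x * h x i)) (toℕ (p j)))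
        ≈⟨ sum-delta (p j) _ (λ x x≢p → coeff-mono-other (toℕ x) _ (toℕ (p j)) (λ e → x≢p (FP.toℕ-injective (P.sym e)))) ⟩
      coeff (mono (toℕ (p j)) (φ j (p j) * h (p j) i)) (toℕ (p j)) ≡⟨ coeff-mono-same (toℕ (p j)) _ ⟩
      φ j (p j) * h (p j) i                                ≈⟨ trans (*-congʳ (proj₁ (proj₂ ech) j)) (*-identityˡ _) ⟩
      h (p j) i                                            ∎

    -- det N⁺ has exact degree S: its top coefficient is a maximal minor of h.
    degree-det-N⁺ : Deg≡ (DetP.det r (N⁺ φ)) S
    degree-det-N⁺ = proj₁ top , λ top≈0 → h-minors p (proj₁ ech)
      (trans (det≈ r _) (trans (DetF.det-cong r (λ i j → sym (top-N⁺ i j))) (trans (sym (proj₂ top)) top≈0)))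
      where
      top : Deg≤ (DetP.det r (N⁺ φ)) S × (coeff (DetP.det r (N⁺ φ)) S ≈ DetF.det r (λ i j → coeff (N⁺ φ i j) (toℕ (p j))))
      top = det-degree r (N⁺ φ) (toℕ ∘ p) degree-N⁺

    -- det N⁺ = X^E · det N, hence det N has exact degree S - E.
    degree-det-N : Deg≡ (DetP.det r (N φ)) (S ∸ E)
    degree-det-N = proj₂ (Deg≡-X^* E (DetP.det r (N φ)) S (Deg≡-cong shift degree-det-N⁺))
      where
      shift : DetP.det r (N⁺ φ) ≋ mono E 1# *ᴾ DetP.det r (N φ)
      shift = ≋-trans (DetP.det-cong r (λ i j → ≋-sym (shift-N φ i j)))
              (≋-trans (DetP.det-scale-rows r (λ i → mono (toℕ i) 1#) (N φ)) (*ᴾ-congˡ _ (prod-monomials r toℕ)))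

    -- S - E ≤ Σ (s + j) - Σ j = r·s.
    degree-bound : S ∸ E ℕ.≤ r ℕ.* s
    degree-bound = P.subst (S ∸ E ℕ.≤_) (NP.m+n∸n≡m (r ℕ.* s) E)
      (NP.∸-monoˡ-≤ E (P.subst (S ℕ.≤_) (sumℕ-+ r s toℕ) (sumℕ-mono r _ _ (pivot-bound p (proj₁ ech)))))

    multiplicities-bound : ∀ K (ts : Fin K → Carrier) → (∀ i j → ts i ≈ ts j → i ≡ j) → (ks : Fin K → ℕ) →
      (∀ l → ¬ ¬ Divides (ks l) (ts l) (DetP.det r (N φ))) → Defs.sumℕ K ks ℕ.≤ r ℕ.* s
    multiplicities-bound K ts distinct ks divides = decidable-stable (Defs.sumℕ K ks ℕ.≤? r ℕ.* s)
      (¬¬-map (λ all → NP.≤-trans (multiplicity-bound K ts distinct ks (S ∸ E) (DetP.det r (N φ)) degree-det-N all) degree-bound)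
              (¬¬-all K divides))

-- The vectors a^[n](t) form a triangular family
-- (the minor for ι q = q is triangular, so its diagonal is nonzero); hence
-- H(t) has rank r and H(t)^⊥ has rank s.  For the design bounds, let W be
-- spanned by independent w and φ a reversed echelon family: a basis of W
-- for H(t)^⊥ ∩ W, and r vectors spanning W^⊥ (W of rank s) for H(t) ∩ W.
-- Independent vectors of the intersection give as many independent kernel
-- vectors at t of the pairing matrix N φ (or of its transpose), so the
-- ranks are bounded by root multiplicities of det N φ, which add up to r·s.
module Design {c ℓ} (F : Defs.Field c ℓ) (r s : Data.Nat.ℕ)
  (h : Data.Fin.Fin (r Data.Nat.+ s) → Data.Fin.Fin r → Defs.Field.Carrier F)
  (h-lower : ∀ i n → Data.Nat._<_ (Data.Fin.toℕ i) (Data.Fin.toℕ n) → Defs.Field._≈_ F (h i n) (Defs.Field.0# F))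
  (h-minors : ∀ (ι : Data.Fin.Fin r → Data.Fin.Fin (r Data.Nat.+ s)) →
              (∀ p q → Data.Fin._<_ p q → Data.Fin._<_ (ι p) (ι q)) →
              Relation.Nullary.¬_ (Defs.Field._≈_ F (Defs.LinAlg.det F r (λ n q → h (ι q) n)) (Defs.Field.0# F)))
  where

  open import Data.Nat as ℕ using (ℕ; suc; _∸_)
  import Data.Nat.Properties as NP
  open import Data.Fin as Fin using (Fin; toℕ; _↑ˡ_; _↑ʳ_)
  import Data.Fin.Properties as FP
  open import Data.Product using (_,_; _×_; proj₁; proj₂)
  open import Relation.Binary.PropositionalEquality as P using (_≡_)
  open import Relation.Nullary using (¬_)
  open import Relation.Nullary.Negation using (¬¬-map)
  open import Relation.Nullary.Decidable using (decidable-stable)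
  open import Algebra.Bundles using (CommutativeRing)

  open RootMultiplicity F
  open Echelon F hiding (R; module DetF)
  open Orthogonality F
  open KernelMultiplicity F
  open PairingMatrix F r s h h-lower h-minors
  open CommutativeRing R
  open import Relation.Binary.Reasoning.Setoid setoid
  open DetF using (sum; sum-cong-≋; sum-0; sum-delta)
  open Defs.LinAlg F using (Vect; _≈ᵥ_; lincomb; LinIndep; dot; Span; Perp; Hsp; aVec; RankAtLeast; HasRank; StrongDesign; _∩_; pow)

  a : Carrier → Fin r → Vect m
  a t n = aVec h n t

  -- The diagonal entries h(n, n) are nonzero: the minor of the first r rows is
  -- triangular with this diagonal.

  ι : Fin r → Fin m
  ι q = q ↑ˡ s

  h-diagonal : ∀ n → ¬ (h (ι n) n ≈ 0#)
  h-diagonal n h≈0 = h-minors ι (λ p q p<q → P.subst₂ ℕ._<_ (P.sym (FP.toℕ-↑ˡ p s)) (P.sym (FP.toℕ-↑ˡ q s)) p<q)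
    (trans (det≈ r _) (trans (DetF.det-upper-triangular r (λ n q → h (ι q) n) below) (DetF.prod-zero r (λ i → h (ι i) i) n h≈0)))
    where below : ∀ p q → toℕ q ℕ.< toℕ p → h (ι q) p ≈ 0#
          below p q q<p = h-lower (ι q) p (P.subst (ℕ._< toℕ p) (P.sym (FP.toℕ-↑ˡ q s)) q<p)

  a-triangular : ∀ t → Triangular r s (a t)
  a-triangular t = (λ n x x<n → trans (*-congʳ (h-lower x n x<n)) (zeroˡ _)) ,
                   (λ n a≈0 → h-diagonal n (trans (sym (trans (*-congˡ (pow-diagonal n)) (*-identityʳ _))) a≈0))
    where pow-diagonal : ∀ n → pow t (toℕ (ι n) ∸ toℕ n) ≈ 1#
          pow-diagonal n = reflexive (P.cong (pow t) (P.trans (P.cong (_∸ toℕ n) (FP.toℕ-↑ˡ n s)) (NP.n∸n≡0 (toℕ n))))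

  a∈H : ∀ t n → Hsp h t (a t n)
  a∈H t n = std n , λ i → sym (begin
    lincomb (std n) (a t) i      ≈⟨ lc≈ (std n) (a t) i ⟩
    sum (λ q → std n q * a t q i) ≈⟨ sum-delta n _ (λ q q≢n → trans (*-congʳ (std-other n q q≢n)) (zeroˡ _)) ⟩
    std n n * a t n i            ≈⟨ trans (*-congʳ (std-same n)) (*-identityˡ _) ⟩
    a t n i                      ∎)

  ⊥-generators : ∀ t x → (∀ n → dot x (a t n) ≈ 0#) → Perp (Hsp h t) x
  ⊥-generators t x x⊥a y (cs , y≈) = trans (dot-congʳ x y≈)
    (trans (dot-lc-r x cs (a t)) (sum-0 (λ q → trans (*-congˡ (x⊥a q)) (zeroʳ _))))

  -- The ranks.  In both cases too many independent vectors would give too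
  -- many independent coordinate vectors.

  H-rank : ∀ t → HasRank (Hsp h t) r
  H-rank t = (a t , a∈H t , triangular-indep r s (a t) (a-triangular t)) , λ { (y , y∈H , ind) →
    too-many-vectors r (λ q → proj₁ (y∈H q)) (indep-coeffs y (λ q → proj₁ (y∈H q)) (a t) (λ q → proj₂ (y∈H q)) ind) }

  -- H(t)^⊥ contains s independent vectors orthogonal to the triangular family,
  -- and a vector of H(t)^⊥ is determined by its last s coordinates.
  H⊥-rank : ∀ t → HasRank (Perp (Hsp h t)) s
  H⊥-rank t with triangular-complement r s (a t) (a-triangular t)
  ... | x , x⊥a , ind = (x , (λ j → ⊥-generators t (x j) (x⊥a j)) , ind) , λ { (y , y⊥H , ind) →
    too-many-vectors s (last-coordinates y) (last-indep y y⊥H ind) }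
    where
    last-coordinates : (Fin (suc s) → Vect m) → Fin (suc s) → Vect s
    last-coordinates y q j = y q (r ↑ʳ j)
    last-indep : ∀ y → (∀ q → Perp (Hsp h t) (y q)) → LinIndep y → LinIndep (last-coordinates y)
    last-indep y y⊥H ind cs lc≈0 = ind cs (triangular-complement-zero r s (a t) (a-triangular t) (lincomb cs y)
      (λ n → trans (dot-lc-l cs y (a t n)) (sum-0 (λ q → trans (*-congˡ (y⊥H q (a t n) (a∈H t n))) (zeroʳ (cs q)))))
      lc≈0)

  -- y ∈ H(t) ∩ W and φ ⊥ W: the coordinates of y in the a^[i](t) are in the
  -- left kernel of N φ at t.
  H∩W-multiplicity : ∀ (w : Fin s → Vect m) (φ : Fin r → Vect m) → (∀ j l → dot (φ j) (w l) ≈ 0#) →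
    ∀ t k → RankAtLeast (Hsp h t ∩ Span w) k → ¬ ¬ Divides k t (DetP.det r (N φ))
  H∩W-multiplicity w φ φ⊥w t k (y , y∈H∩W , ind) =
    kernel-multiplicity k r (N φ) t cs (indep-coeffs y cs (a t) (λ q → proj₂ (proj₁ (y∈H∩W q))) ind) kernel
    where
    cs : Fin k → Fin r → Carrier
    cs q = proj₁ (proj₁ (y∈H∩W q))
    kernel : ∀ q → LeftKernel (N φ) t (cs q)
    kernel q j = begin
      sum (λ i → cs q i * eval (N φ i j) t)       ≈⟨ sum-cong-≋ {r} (λ i → *-congˡ (eval-N φ i j t)) ⟩
      sum (λ i → cs q i * dot (φ j) (a t i))      ≈⟨ sym (dot-lc-r (φ j) (cs q) (a t)) ⟩
      dot (φ j) (lincomb (cs q) (a t))            ≈⟨ sym (dot-congʳ (φ j) (proj₂ (proj₁ (y∈H∩W q)))) ⟩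
      dot (φ j) (y q)                             ≈⟨ dot-congʳ (φ j) (proj₂ (proj₂ (y∈H∩W q))) ⟩
      dot (φ j) (lincomb (proj₁ (proj₂ (y∈H∩W q))) w) ≈⟨ dot-lc-r (φ j) _ w ⟩
      sum (λ l → proj₁ (proj₂ (y∈H∩W q)) l * dot (φ j) (w l)) ≈⟨ sum-0 {s} (λ l → trans (*-congˡ (φ⊥w j l)) (zeroʳ _)) ⟩
      0#                                          ∎

  -- y ∈ H(t)^⊥ ∩ W and φ a basis of W: the coordinates of y in φ are in the
  -- left kernel of the transpose of N φ at t.
  H⊥∩W-multiplicity : ∀ (w : Fin r → Vect m) (φ : Fin r → Vect m) → (∀ l → Span φ (w l)) →
    ∀ t k → RankAtLeast (Perp (Hsp h t) ∩ Span w) k → ¬ ¬ Divides k t (DetP.det r (N φ))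
  H⊥∩W-multiplicity w φ φ-spans t k (y , y∈H⊥∩W , ind) =
    ¬¬-map (λ { (Q , e) → Q , ≋-trans (≋-sym (DetP.det-transpose r (N φ))) e })
      (kernel-multiplicity k r (λ j i → N φ i j) t μ (indep-coeffs y μ φ y≈ ind) kernel)
    where
    d : Fin k → Fin r → Carrier
    d q = proj₁ (proj₂ (y∈H⊥∩W q))
    μ : Fin k → Fin r → Carrier
    μ q j = sum (λ l → d q l * proj₁ (φ-spans l) j)
    y≈ : ∀ q → y q ≈ᵥ lincomb (μ q) φ
    y≈ q i = trans (proj₂ (proj₂ (y∈H⊥∩W q)) i)
      (trans (lc-congᵥ (d q) (λ l → proj₂ (φ-spans l)) i) (lc-lc (d q) (λ l → proj₁ (φ-spans l)) φ i))
    kernel : ∀ q → LeftKernel (λ j i → N φ i j) t (μ q)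
    kernel q i = begin
      sum (λ j → μ q j * eval (N φ i j) t)  ≈⟨ sum-cong-≋ {r} (λ j → *-congˡ (eval-N φ i j t)) ⟩
      sum (λ j → μ q j * dot (φ j) (a t i)) ≈⟨ sym (dot-lc-l (μ q) φ (a t i)) ⟩
      dot (lincomb (μ q) φ) (a t i)         ≈⟨ sym (dot-congˡ (a t i) (y≈ q)) ⟩
      dot (y q) (a t i)                     ≈⟨ proj₁ (y∈H⊥∩W q) (a t i) (a∈H t i) ⟩
      0#                                    ∎

  H-design : ∀ (w : Fin s → Vect m) → LinIndep w → ∀ K (ts : Fin K → Carrier) → (∀ i j → ts i ≈ ts j → i ≡ j) →
    ∀ (ks : Fin K → ℕ) → (∀ l → RankAtLeast (Hsp h (ts l) ∩ Span w) (ks l)) → Defs.sumℕ K ks ℕ.≤ r ℕ.* s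
  H-design w ind K ts distinct ks rank = decidable-stable (Defs.sumℕ K ks ℕ.≤? r ℕ.* s)
    (¬¬-map bound (rev-echelon-complement m s w ind))
    where
    bound : RevEchelonComplement m s w → Defs.sumℕ K ks ℕ.≤ r ℕ.* s
    bound (r' , r'+s≡m , φ , p , ech , φ⊥w) with NP.+-cancelʳ-≡ s r' r r'+s≡m
    ... | P.refl = EchelonPairing.multiplicities-bound φ p ech K ts distinct ks
                     (λ l → H∩W-multiplicity w φ φ⊥w (ts l) (ks l) (rank l))

  H⊥-design : ∀ (w : Fin r → Vect m) → LinIndep w → ∀ K (ts : Fin K → Carrier) → (∀ i j → ts i ≈ ts j → i ≡ j) →
    ∀ (ks : Fin K → ℕ) → (∀ l → RankAtLeast (Perp (Hsp h (ts l)) ∩ Span w) (ks l)) → Defs.sumℕ K ks ℕ.≤ s ℕ.* r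
  H⊥-design w ind K ts distinct ks rank = P.subst (Defs.sumℕ K ks ℕ.≤_) (NP.*-comm r s)
    (decidable-stable (Defs.sumℕ K ks ℕ.≤? r ℕ.* s) (¬¬-map bound (rev-echelon-basis m r w ind)))
    where
    bound : RevEchelonSpanning m r w → Defs.sumℕ K ks ℕ.≤ r ℕ.* s
    bound (φ , p , ech , φ-spans) = EchelonPairing.multiplicities-bound φ p ech K ts distinct ks
      (λ l → H⊥∩W-multiplicity w φ φ-spans (ts l) (ks l) (rank l))

  designs : StrongDesign (λ t → Perp (Hsp h t)) s r (s ℕ.* r) × StrongDesign (Hsp h) r s (r ℕ.* s)
  designs = (H⊥-rank , H⊥-design) , (H-rank , H-design)

open import Defs
open import Data.Nat using (ℕ; _+_; _*_; _≤_; _<_)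
open import Data.Fin using (Fin; toℕ)
import Data.Fin as Fin
open import Data.Product using (_×_)
open import Relation.Nullary using (¬_)
open import Relation.Binary.PropositionalEquality using (_≡_)

-- The theorem.
mainTheorem17 : ∀ {c ℓ} (F : Field c ℓ) → let open LinAlg F in
    (r s : ℕ) → 1 ≤ r → 1 ≤ s →
    (h : Fin (r + s) → Fin r → Carrier) →
    (∀ i n → toℕ n ≡ 0 → h i n ≈ 1#) →
    (∀ i n → toℕ i < toℕ n → h i n ≈ 0#) →
    (∀ (ι : Fin r → Fin (r + s)) → (∀ p q → p Fin.< q → ι p Fin.< ι q) →
    ¬ (det r (λ n q → h (ι q) n) ≈ 0#)) →
    StrongDesign (λ t → Perp (Hsp {r} {s} h t)) s r (s * r)
    × StrongDesign (Hsp {r} {s} h) r s (r * s)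
mainTheorem17 F r s _ _ h _ h-lower h-minors = Design.designs F r s h h-lower h-minors
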